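{- Consider any instance of the Virtual Network Embedding problem (as defined in the context), and let $\pi$ and $\pi'$ be two partitions of $V_r$ into nonempty parts such that $\pi'$ is a refinement of $\pi$ (every part of $\pi'$ is contained in some part of $\pi$). Then $$v(\widetilde{VPF}_{\pi})\ge v(\widetilde{VPF}_{\pi'}).$$ Moreover, the gap between the two can be arbitrarily large: for every $M>0$ there exist an instance and partitions $\pi,\pi'$ of its virtual node set, with $\pi'$ a refinement of $\pi$, such that $v(\widetilde{VPF}_{\pi})-v(\widetilde{VPF}_{\pi'})>M$.
   Context: \textbf{Instance.} The virtual network $G_r=(V_r,E_r)$ and the substrate network $G_s=(V_s,E_s)$ are simple, connected, undirected graphs. Each virtual node $\bar u$ and virtual edge $\bar e$ has an integer demand $d_{\bar u}$, $d_{\bar e}$; each substrate node $u$ and substrate edge $e$ has an integer capacity $c_u$, $c_e$ and an integer unit cost $w_u$, $w_e$. Every edge of $E_r$ and of $E_s$ is given a fixed arbitrary orientation, with start node $s(\cdot)$ and terminal node $t(\cdot)$. For each substrate edge $e$ there are two arcs: $e_+$ (from $s(e)$ to $t(e)$) and $e_-$ (from $t(e)$ to $s(e)$). For $u\in V_s$, $\delta^+(u)=\{e_+: s(e)=u\}\cup\{e_-: t(e)=u\}$ (outgoing arcs) and $\delta^-(u)=\{e_+: t(e)=u\}\cup\{e_-: s(e)=u\}$ (incoming arcs). \textbf{Mappings.} A mapping of a graph $H=(V_H,E_H)$ (a subgraph of $G_r$) onto $G_s$ is a pair $m=(m_V,m_E)$ where $m_V:V_H\to V_s$ is injective (one-to-one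 placement) and $m_E$ assigns to each $\bar e\in E_H$ a loop-free path of $G_s$ between $m_V(s(\bar e))$ and $m_V(t(\bar e))$. It is feasible if for each substrate node (resp. edge) the total demand of the nodes of $H$ placed on it (resp. edges of $H$ routed through it) is at most its capacity. Its cost is $w_m=\sum_{\bar u\in V_H} d_{\bar u} w_{m_V(\bar u)}+\sum_{\bar e\in E_H}\sum_{e\in m_E(\bar e)} d_{\bar e} w_e$. For such $m$ let $\mathrm{X}^m_{\bar u u}=1$ iff $m_V(\bar u)=u$ (else $0$), and $\mathrm{Y}^m_{\bar e e_+}=1$ (resp. $\mathrm{Y}^m_{\bar e e_- }=1$) iff the path $m_E(\bar e)$, traversed from $m_V(s(\bar e))$ to $m_V(t(\bar e))$, uses $e$ from $s(e)$ to $t(e)$ (resp. from $t(e)$ to $s(e)$). \textbf{Virtual Partition Formulation $(VPF_\pi)$.} Let $\pi=(V_r^1,\dots,V_r^{k_r})$ be a partition of $V_r$ into nonempty parts, $H_r^i=(V_r^i,E_r^i)$ the induced subgraph of $G_r$ on $V_r^i$, $E_r^0$ the set of virtual edges whose endpoints lie in different parts (cut edges), and $\mathcal M_i$ the set of feasible mappings of $H_r^i$ onto $G_s$. For a node $\bar v$, let $i(\bar v)$ denote the index of the part containing it. Variables: $\lambda^i_m$ for $m\in\mathcal M_i$, $i=1,\dots,k_r$, and $y_{\bar e a}$ for $\bar e\in E_r^0$ and arcs $a$. Minimize $\sum_{i}\sum_{m\in\mathcal M_i}w_m\lambda^i_m+\sum_{e\in E_s}\sum_{\bar e\in E_r^0}w_e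 d_{\bar e}(y_{\bar e e_+}+y_{\bar e e_- })$ subject to: $\sum_{m\in\mathcal M_i}\lambda^i_m\ge1$ for all $i$; for all $\bar e\in E_r^0,u\in V_s$: $\sum_{m\in\mathcal M_{i(s(\bar e))}}\mathrm{X}^m_{s(\bar e)u}\lambda^{i(s(\bar e))}_m-\sum_{m\in\mathcal M_{i(t(\bar e))}}\mathrm{X}^m_{t(\bar e)u}\lambda^{i(t(\bar e))}_m=\sum_{a\in\delta^+(u)}y_{\bar e a}-\sum_{a\in\delta^-(u)}y_{\bar e a}$; for all $u\in V_s$: $\sum_i\sum_{m\in\mathcal M_i}\sum_{\bar u\in V_r^i}\mathrm{X}^m_{\bar u u}\lambda^i_m\le1$ and $\sum_i\sum_{m\in\mathcal M_i}\sum_{\bar u\in V_r^i}d_{\bar u}\mathrm{X}^m_{\bar u u}\lambda^i_m\le c_u$; for all $e\in E_s$: $\sum_i\sum_{m\in\mathcal M_i}\sum_{\bar e\in E_r^i}d_{\bar e}(\mathrm{Y}^m_{\bar e e_- }+\mathrm{Y}^m_{\bar e e_+})\lambda^i_m+\sum_{\bar e\in E_r^0}d_{\bar e}(y_{\bar e e_+}+y_{\bar e e_- })\le c_e$; for all $\bar e\in E_r^0,u\in V_s$: $\sum_{m\in\mathcal M_{i(s(\bar e))}}\mathrm{X}^m_{s(\bar e)u}\lambda^{i(s(\bar e))}_m\le\sum_{a\in\delta^+(u)}y_{\bar e a}$; all variables binary. Its linear relaxation $(\widetilde{VPF}_\pi)$ replaces binarity by $0\le\cdot\le1$, and $v(\widetilde{VPF}_\pi)$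 is its optimal value. -}

module Defs where

open import Data.Nat as ℕ using (ℕ; zero; suc)
open import Data.Integer using (+_)
open import Data.Rational using (ℚ; 0ℚ; 1ℚ; _/_; _+_; _*_; _-_; _≤_; _<_)
open import Data.Fin using (Fin; zero; suc) renaming (_≟_ to _≟F_)
open import Data.Bool using (Bool; true; false; if_then_else_) renaming (_≟_ to _≟B_)
open import Data.List using (List; []; _∷_; map)
open import Data.List.Relation.Unary.All using (All)
open import Data.List.Relation.Unary.Unique.Propositional using (Unique)
open import Data.Product using (Σ; ∃; _×_; _,_; proj₁; proj₂)
open import Data.Sum using (_⊎_)
open import Relation.Nullary using (¬_; Dec; yes; no)
open import Relation.Binary.PropositionalEquality using (_≡_; _≢_)

ℕ→ℚ : ℕ → ℚ
ℕ→ℚ n = (+ n) / 1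

[_] : ∀ {P : Set} → Dec P → ℚ
[ yes _ ] = 1ℚ
[ no _ ] = 0ℚ

[_]ℕ : ∀ {P : Set} → Dec P → ℕ
[ yes _ ]ℕ = 1
[ no _ ]ℕ = 0

∑ : (n : ℕ) → (Fin n → ℚ) → ℚ
∑ zero f = 0ℚ
∑ (suc n) f = f zero + ∑ n (λ i → f (suc i))

∑ℕ : (n : ℕ) → (Fin n → ℕ) → ℕ
∑ℕ zero f = 0
∑ℕ (suc n) f = f zero ℕ.+ ∑ℕ n (λ i → f (suc i))

∑L : ∀ {A : Set} → List A → (A → ℚ) → ℚ
∑L [] f = 0ℚ
∑L (x ∷ xs) f = f x + ∑L xs f

record Graph : Set where
  field
    n : ℕ
    m : ℕ
    src : Fin m → Fin n
    tgt : Fin m → Fin n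

module _ (G : Graph) where
  open Graph G

  -- arc (e , true) = e₊ : src e → tgt e ; arc (e , false) = e₋ : tgt e → src e
  Arc : Set
  Arc = Fin m × Bool

  tail : Arc → Fin n
  tail (e , true) = src e
  tail (e , false) = tgt e

  head : Arc → Fin n
  head (e , true) = tgt e
  head (e , false) = src e

  data IsWalk : Fin n → List Arc → Fin n → Set where
    nil  : ∀ {u} → IsWalk u [] u
    cons : ∀ {u a as v} → tail a ≡ u → IsWalk (head a) as v → IsWalk u (a ∷ as) v

  IsPath : Fin n → List Arc → Fin n → Set
  IsPath u as v = IsWalk u as v × Unique (u ∷ map head as)

  Simple : Set
  Simple = (∀ e → src e ≢ tgt e)
         × (∀ e e' → ((src e ≡ src e' × tgt e ≡ tgt e') ⊎ (src e ≡ tgt e' × tgt e ≡ src e'))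
                   → e ≡ e')

  Connected : Set
  Connected = ∀ u v → ∃ λ as → IsWalk u as v

  count : Arc → List Arc → ℕ
  count a [] = 0
  count (e , b) ((e' , b') ∷ as) with e ≟F e' | b ≟B b'
  ... | yes _ | yes _ = suc (count (e , b) as)
  ... | _     | _     = count (e , b) as

record Instance : Set where
  field
    Gr : Graph            -- virtual network
    Gs : Graph            -- substrate network
    dV : Fin (Graph.n Gr) → ℕ
    dE : Fin (Graph.m Gr) → ℕ
    cV : Fin (Graph.n Gs) → ℕ
    cE : Fin (Graph.m Gs) → ℕ
    wV : Fin (Graph.n Gs) → ℕ
    wE : Fin (Graph.m Gs) → ℕ

ValidInstance : Instance → Set
ValidInstance I = Simple Gr × Connected Gr × Simple Gs × Connected Gs
  where open Instance I

record Partition (n : ℕ) : Set where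
  field
    k : ℕ
    part : Fin n → Fin k
    nonempty : ∀ i → ∃ λ x → part x ≡ i

Refines : ∀ {n} → Partition n → Partition n → Set
Refines π' π = ∀ x y → Partition.part π' x ≡ Partition.part π' y → Partition.part π x ≡ Partition.part π y

module VPF (I : Instance) (π : Partition (Graph.n (Instance.Gr I))) where
  open Instance I
  open Partition π

  nr = Graph.n Gr
  er = Graph.m Gr
  ns = Graph.n Gs
  es = Graph.m Gs
  rs = Graph.src Gr
  rt = Graph.tgt Gr

  inPart : Fin k → Fin nr → Set
  inPart i x = part x ≡ i

  edgeIn : Fin k → Fin er → Set
  edgeIn i ē = part (rs ē) ≡ i × part (rt ē) ≡ i

  edgeIn? : ∀ i ē → Dec (edgeIn i ē)
  edgeIn? i ē with part (rs ē) ≟F i | part (rt ē) ≟F i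
  ... | yes p | yes q = yes (p , q)
  ... | no ¬p | _     = no (λ z → ¬p (proj₁ z))
  ... | yes _ | no ¬q = no (λ z → ¬q (proj₂ z))

  Cut : Fin er → Set
  Cut ē = part (rs ē) ≢ part (rt ē)

  cut? : ∀ ē → Dec (Cut ē)
  cut? ē with part (rs ē) ≟F part (rt ē)
  ... | yes p = no (λ ¬p → ¬p p)
  ... | no ¬p = yes ¬p

  -- A mapping of H_r^i.  The components are given as total functions, but
  -- only their values on V_r^i (resp. E_r^i) are meaningful: all conditions
  -- below only read those values.
  record Mapping (i : Fin k) : Set where
    field
      mV : Fin nr → Fin ns
      mE : Fin er → List (Arc Gs)

  module _ {i : Fin k} (mp : Mapping i) where
    open Mapping mp

    X : Fin nr → Fin ns → ℕ
    X x u = [ mV x ≟F u ]ℕ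

    -- Y^m_{ē a}: number of times path m_E(ē) uses arc a (0 or 1 for loop-free paths)
    Y : Fin er → Arc Gs → ℕ
    Y ē a = count Gs a (mE ē)

    nodeLoad : Fin ns → ℕ
    nodeLoad u = ∑ℕ nr (λ x → [ part x ≟F i ]ℕ ℕ.* (dV x ℕ.* X x u))

    edgeLoad : Fin es → ℕ
    edgeLoad e = ∑ℕ er (λ ē → [ edgeIn? i ē ]ℕ ℕ.* (dE ē ℕ.* (Y ē (e , false) ℕ.+ Y ē (e , true))))

    IsFeasibleMapping : Set
    IsFeasibleMapping =
        (∀ x y → inPart i x → inPart i y → mV x ≡ mV y → x ≡ y)
      × (∀ ē → edgeIn i ē → IsPath Gs (mV (rs ē)) (mE ē) (mV (rt ē)))
      × (∀ u → nodeLoad u ℕ.≤ cV u)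
      × (∀ e → edgeLoad e ℕ.≤ cE e)

    mcost : ℕ
    mcost = ∑ℕ nr (λ x → [ part x ≟F i ]ℕ ℕ.* (dV x ℕ.* wV (mV x)))
        ℕ.+ ∑ℕ er (λ ē → [ edgeIn? i ē ]ℕ ℕ.*
                 ∑ℕ es (λ e → (Y ē (e , true) ℕ.+ Y ē (e , false)) ℕ.* (dE ē ℕ.* wE e)))

  FeasMapping : Fin k → Set
  FeasMapping i = Σ (Mapping i) IsFeasibleMapping

  -- The variables λ^i_m (one per
  -- feasible mapping m ∈ M_i) are represented by a finite list of weighted
  -- feasible mappings; the value of λ^i_m is the total weight of the entries
  -- equal to m (absent mappings have λ^i_m = 0).  y_{ē a} is given for all
  -- virtual edges but only used for cut edges.
  record Solution : Set where
    field
      lam : (i : Fin k) → List (FeasMapping i × ℚ)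
      y : Fin er → Arc Gs → ℚ

  module _ (S : Solution) where
    open Solution S

    ∑λ : (i : Fin k) → ({j : Fin k} → Mapping j → ℚ) → ℚ
    ∑λ i f = ∑L (lam i) (λ entry → f (proj₁ (proj₁ entry)) * proj₂ entry)

    Xagg : Fin nr → Fin ns → ℚ
    Xagg x u = ∑λ (part x) (λ mp → ℕ→ℚ (X mp x u))

    outflow inflow : Fin er → Fin ns → ℚ
    outflow ē u = ∑ es (λ e → [ tail Gs (e , true) ≟F u ] * y ē (e , true)
                            + [ tail Gs (e , false) ≟F u ] * y ē (e , false))
    inflow ē u = ∑ es (λ e → [ head Gs (e , true) ≟F u ] * y ē (e , true)
                           + [ head Gs (e , false) ≟F u ] * y ē (e , false))

    objective : ℚ
    objective = ∑ k (λ i → ∑λ i (λ mp → ℕ→ℚ (mcost mp)))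
              + ∑ es (λ e → ∑ er (λ ē → [ cut? ē ] * (ℕ→ℚ (wE e ℕ.* dE ē) * (y ē (e , true) + y ē (e , false)))))

    IsFeasible : Set
    IsFeasible =
        (∀ i → All (λ entry → 0ℚ ≤ proj₂ entry × proj₂ entry ≤ 1ℚ) (lam i))
      × (∀ ē a → Cut ē → 0ℚ ≤ y ē a × y ē a ≤ 1ℚ)
      × (∀ i → 1ℚ ≤ ∑L (lam i) proj₂)
      × (∀ ē u → Cut ē → Xagg (rs ē) u - Xagg (rt ē) u ≡ outflow ē u - inflow ē u)
      × (∀ u → ∑ k (λ i → ∑λ i (λ {j} mp → ∑ nr (λ x → [ part x ≟F j ] * ℕ→ℚ (X mp x u)))) ≤ 1ℚ)
      × (∀ u → ∑ k (λ i → ∑λ i (λ {j} mp → ∑ nr (λ x → [ part x ≟F j ] * ℕ→ℚ (dV x ℕ.* X mp x u)))) ≤ ℕ→ℚ (cV u))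
      × (∀ e → ∑ k (λ i → ∑λ i (λ mp → ℕ→ℚ (edgeLoad mp e)))
               + ∑ er (λ ē → [ cut? ē ] * (ℕ→ℚ (dE ē) * (y ē (e , true) + y ē (e , false))))
             ≤ ℕ→ℚ (cE e))
      × (∀ ē u → Cut ē → Xagg (rs ē) u ≤ outflow ē u)

  IsOptimalValue : ℚ → Set
  IsOptimalValue v =
      (∃ λ S → IsFeasible S × objective S ≡ v)
    × (∀ S → IsFeasible S → v ≤ objective S)

-- A feasible solution of the relaxation for π yields one for a refinement π′
-- at no larger cost: every part of π′ takes over the columns of the part of π
-- containing it, with the weights divided by that part's total weight T ≥ 1,
-- and a virtual edge that becomes cut is routed along the weighted average of
-- the paths chosen by those columns.  Node placements and arc flows of virtual
-- edges, through which all constraints and the objective can be written, are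
-- thereby multiplied by 1/T ≤ 1; flow conservation and linking survive because
-- T is equal at both ends of a cut edge (sum its conservation constraints over
-- all substrate nodes).
-- For the gap, a single virtual edge must cross a substrate edge of cost B when
-- both endpoints lie in one part, whereas with singleton parts each endpoint
-- can be split evenly between the two admissible substrate nodes at cost 0.

module Submission where

open import Defs
open import Data.Rational using (ℚ; 0ℚ; _≤_; _<_; _-_)
open import Data.Product using (Σ; ∃; _×_)
open import Data.Nat using (ℕ)

open import Algebra.Bundles using (CommutativeRing)
open import Data.Bool using (Bool; true; false; if_then_else_) renaming (_≟_ to _≟B_)
open import Data.Empty using (⊥-elim)
open import Data.Unit using (tt)
open import Data.Fin using (Fin; zero; suc; inject₁) renaming (_≟_ to _≟F_)
open import Data.Fin.Patterns using (0F; 1F; 2F; 3F)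
import Data.Fin.Properties as Fin
open import Data.Integer as ℤ using ()
import Data.Integer.Properties as ℤ
open import Data.List using (List; []; _∷_; map; _++_)
open import Data.List.Relation.Unary.All as All using (All; []; _∷_)
import Data.List.Relation.Unary.All.Properties as All
open import Data.List.Relation.Unary.AllPairs using ([]; _∷_)
open import Data.List.Relation.Unary.Unique.Propositional using (Unique)
import Data.Nat as ℕ
import Data.Nat.Properties as ℕ
open import Data.Product using (_,_; proj₁; proj₂)
open import Data.Sum using (_⊎_; inj₁; inj₂)
open import Data.Rational using (mkℚ; *<*; 1ℚ; ½; _+_; _*_; -_; 1/_; toℚᵘ; NonZero; Positive; nonNegative; positive)
open import Data.Rational.Properties
open import Data.Rational.Solver using (module +-*-Solver)
open import Data.Nat.Solver using () renaming (module +-*-Solver to ℕ-Solver)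
import Data.Rational.Unnormalised as ℚᵘ
import Data.Rational.Unnormalised.Properties as ℚᵘ
open import Relation.Nullary using (¬_; Dec; yes; no; does)
open import Relation.Nullary.Decidable using (decidable-stable)
open import Relation.Binary.PropositionalEquality hiding ([_])

open import Algebra.Properties.Group +-0-group using (x∙y⁻¹≈ε⇒x≈y)
open import Algebra.Properties.Ring +-*-ring using (x[y-z]≈xy-xz)
import Algebra.Properties.CommutativeMonoid.Sum +-0-commutativeMonoid as Sum
import Algebra.Properties.Semiring.Sum (CommutativeRing.semiring +-*-commutativeRing) as SemiringSum

private
  ℕ→ℚᵘ : ℕ → ℚᵘ.ℚᵘ
  ℕ→ℚᵘ n = ℚᵘ.mkℚᵘ (ℤ.+ n) 0

  toℚᵘ-ℕ→ℚ : ∀ n → toℚᵘ (ℕ→ℚ n) ℚᵘ.≃ ℕ→ℚᵘ n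
  toℚᵘ-ℕ→ℚ n = toℚᵘ-fromℚᵘ (ℕ→ℚᵘ n)

ℕ→ℚ-homo-+ : ∀ m n → ℕ→ℚ (m ℕ.+ n) ≡ ℕ→ℚ m + ℕ→ℚ n
ℕ→ℚ-homo-+ m n = toℚᵘ-injective (begin
  toℚᵘ (ℕ→ℚ (m ℕ.+ n))            ≈⟨ toℚᵘ-ℕ→ℚ (m ℕ.+ n) ⟩
  ℕ→ℚᵘ (m ℕ.+ n)                  ≈⟨ ℚᵘ.*≡* (cong (ℤ._* ℤ.+ 1) (trans (ℤ.pos-+ m n)
                                        (sym (cong₂ ℤ._+_ (ℤ.*-identityʳ (ℤ.+ m)) (ℤ.*-identityʳ (ℤ.+ n)))))) ⟩
  ℕ→ℚᵘ m ℚᵘ.+ ℕ→ℚᵘ n              ≈⟨ ℚᵘ.+-cong (toℚᵘ-ℕ→ℚ m) (toℚᵘ-ℕ→ℚ n) ⟨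
  toℚᵘ (ℕ→ℚ m) ℚᵘ.+ toℚᵘ (ℕ→ℚ n)  ≈⟨ toℚᵘ-homo-+ (ℕ→ℚ m) (ℕ→ℚ n) ⟨
  toℚᵘ (ℕ→ℚ m + ℕ→ℚ n)            ∎)
  where open ℚᵘ.≃-Reasoning

ℕ→ℚ-homo-* : ∀ m n → ℕ→ℚ (m ℕ.* n) ≡ ℕ→ℚ m * ℕ→ℚ n
ℕ→ℚ-homo-* m n = toℚᵘ-injective (begin
  toℚᵘ (ℕ→ℚ (m ℕ.* n))            ≈⟨ toℚᵘ-ℕ→ℚ (m ℕ.* n) ⟩
  ℕ→ℚᵘ (m ℕ.* n)                  ≈⟨ ℚᵘ.*≡* (cong (ℤ._* ℤ.+ 1) (ℤ.pos-* m n)) ⟩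
  ℕ→ℚᵘ m ℚᵘ.* ℕ→ℚᵘ n              ≈⟨ ℚᵘ.*-cong (toℚᵘ-ℕ→ℚ m) (toℚᵘ-ℕ→ℚ n) ⟨
  toℚᵘ (ℕ→ℚ m) ℚᵘ.* toℚᵘ (ℕ→ℚ n)  ≈⟨ toℚᵘ-homo-* (ℕ→ℚ m) (ℕ→ℚ n) ⟨
  toℚᵘ (ℕ→ℚ m * ℕ→ℚ n)            ∎)
  where open ℚᵘ.≃-Reasoning

ℕ→ℚ-mono-≤ : ∀ {m n} → m ℕ.≤ n → ℕ→ℚ m ≤ ℕ→ℚ n
ℕ→ℚ-mono-≤ {m} {n} m≤n = toℚᵘ-cancel-≤ (begin
  toℚᵘ (ℕ→ℚ m)  ≃⟨ toℚᵘ-ℕ→ℚ m ⟩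
  ℕ→ℚᵘ m        ≤⟨ ℚᵘ.*≤* (ℤ.*-monoʳ-≤-nonNeg (ℤ.+ 1) (ℤ.+≤+ m≤n)) ⟩
  ℕ→ℚᵘ n        ≃⟨ toℚᵘ-ℕ→ℚ n ⟨
  toℚᵘ (ℕ→ℚ n)  ∎)
  where open ℚᵘ.≤-Reasoning

0≤ℕ→ℚ : ∀ n → 0ℚ ≤ ℕ→ℚ n
0≤ℕ→ℚ n = ℕ→ℚ-mono-≤ {0} {n} ℕ.z≤n

ℚ-archimedean : ∀ p → ∃ λ n → p < ℕ→ℚ n
ℚ-archimedean p@(mkℚ i d-1 _) = ℕ.suc ℤ.∣ i ∣ , toℚᵘ-cancel-< (begin-strict
  toℚᵘ p                     <⟨ ℚᵘ.*<* (numerator-bound i) ⟩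
  ℕ→ℚᵘ (ℕ.suc ℤ.∣ i ∣)        ≃⟨ toℚᵘ-ℕ→ℚ (ℕ.suc ℤ.∣ i ∣) ⟨
  toℚᵘ (ℕ→ℚ (ℕ.suc ℤ.∣ i ∣))  ∎)
  where
  open ℚᵘ.≤-Reasoning
  numerator-bound : ∀ i → i ℤ.* ℤ.+ 1 ℤ.< ℤ.+ ℕ.suc ℤ.∣ i ∣ ℤ.* ℤ.+ ℕ.suc d-1
  numerator-bound (ℤ.+ a) rewrite sym (ℤ.pos-* a 1) | sym (ℤ.pos-* (ℕ.suc a) (ℕ.suc d-1)) =
    ℤ.+<+ (ℕ.≤-trans (ℕ.s≤s (ℕ.≤-reflexive (ℕ.*-identityʳ a))) (ℕ.m≤m*n (ℕ.suc a) (ℕ.suc d-1)))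
  numerator-bound ℤ.-[1+ a ] = ℤ.-<+

[]ℕ→ℚ : ∀ {P : Set} (d : Dec P) → ℕ→ℚ [ d ]ℕ ≡ [ d ]
[]ℕ→ℚ (yes _) = refl
[]ℕ→ℚ (no _)  = refl

0≤[] : ∀ {P : Set} (d : Dec P) → 0ℚ ≤ [ d ]
0≤[] (yes _) = 0≤ℕ→ℚ 1
0≤[] (no _)  = ≤-refl

[]-⇔ : ∀ {P Q : Set} (d : Dec P) (d′ : Dec Q) → (P → Q) → (Q → P) → [ d ] ≡ [ d′ ]
[]-⇔ (yes _) (yes _) _   _   = refl
[]-⇔ (yes p) (no ¬q) p→q _   = ⊥-elim (¬q (p→q p))
[]-⇔ (no ¬p) (yes q) _   q→p = ⊥-elim (¬p (q→p q))
[]-⇔ (no _)  (no _)  _   _   = refl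

[]ℕ-mono : ∀ {P Q : Set} (d : Dec P) (d′ : Dec Q) → (P → Q) → [ d ]ℕ ℕ.≤ [ d′ ]ℕ
[]ℕ-mono (yes _) (yes _) _   = ℕ.≤-refl
[]ℕ-mono (yes p) (no ¬q) p→q = ⊥-elim (¬q (p→q p))
[]ℕ-mono (no _)  _       _   = ℕ.z≤n

0≤* : ∀ {p q} → 0ℚ ≤ p → 0ℚ ≤ q → 0ℚ ≤ p * q
0≤* {p} {q} 0≤p 0≤q = nonNegative⁻¹ (p * q) {{nonNeg*nonNeg⇒nonNeg p {{nonNegative 0≤p}} q {{nonNegative 0≤q}}}}

*-monoˡ-≤-≥0 : ∀ {r p q} → 0ℚ ≤ r → p ≤ q → r * p ≤ r * q
*-monoˡ-≤-≥0 {r} 0≤r = *-monoˡ-≤-nonNeg r {{nonNegative 0≤r}}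

≤1⇒*≤ : ∀ {c p} → 0ℚ ≤ c → c ≤ 1ℚ → 0ℚ ≤ p → c * p ≤ p
≤1⇒*≤ {c} {p} 0≤c c≤1 0≤p = begin
  c * p   ≤⟨ *-monoʳ-≤-nonNeg p {{nonNegative 0≤p}} c≤1 ⟩
  1ℚ * p  ≡⟨ *-identityˡ p ⟩
  p       ∎
  where open ≤-Reasoning

∑≡sum : ∀ n (f : Fin n → ℚ) → ∑ n f ≡ Sum.sum f
∑≡sum ℕ.zero    f = refl
∑≡sum (ℕ.suc n) f = cong (f zero +_) (∑≡sum n (λ i → f (suc i)))

∑-cong : ∀ n {f g : Fin n → ℚ} → (∀ i → f i ≡ g i) → ∑ n f ≡ ∑ n g
∑-cong ℕ.zero    f≗g = refl
∑-cong (ℕ.suc n) f≗g = cong₂ _+_ (f≗g zero) (∑-cong n (λ i → f≗g (suc i)))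

∑-distrib-+ : ∀ n (f g : Fin n → ℚ) → ∑ n (λ i → f i + g i) ≡ ∑ n f + ∑ n g
∑-distrib-+ n f g
  rewrite ∑≡sum n (λ i → f i + g i) | ∑≡sum n f | ∑≡sum n g = Sum.∑-distrib-+ f g

*-distribˡ-∑ : ∀ n c (f : Fin n → ℚ) → c * ∑ n f ≡ ∑ n (λ i → c * f i)
*-distribˡ-∑ n c f rewrite ∑≡sum n f | ∑≡sum n (λ i → c * f i) = SemiringSum.*-distribˡ-sum c f

∑-zero : ∀ n → ∑ n (λ _ → 0ℚ) ≡ 0ℚ
∑-zero n rewrite ∑≡sum n (λ _ → 0ℚ) = Sum.sum-replicate-zero n

∑-comm : ∀ n m (f : Fin n → Fin m → ℚ) →
         ∑ n (λ i → ∑ m (f i)) ≡ ∑ m (λ j → ∑ n (λ i → f i j))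
∑-comm n m f = begin
  ∑ n (λ i → ∑ m (f i))                   ≡⟨ ∑-cong n (λ i → ∑≡sum m (f i)) ⟩
  ∑ n (λ i → Sum.sum (f i))               ≡⟨ ∑≡sum n _ ⟩
  Sum.sum (λ i → Sum.sum (f i))           ≡⟨ Sum.∑-comm f ⟩
  Sum.sum (λ j → Sum.sum (λ i → f i j))   ≡⟨ ∑≡sum m _ ⟨
  ∑ m (λ j → Sum.sum (λ i → f i j))       ≡⟨ ∑-cong m (λ j → ∑≡sum n (λ i → f i j)) ⟨
  ∑ m (λ j → ∑ n (λ i → f i j))           ∎
  where open ≡-Reasoning

∑-neg : ∀ n (f : Fin n → ℚ) → ∑ n (λ i → - f i) ≡ - ∑ n f
∑-neg ℕ.zero    f = refl
∑-neg (ℕ.suc n) f = trans (cong (- f zero +_) (∑-neg n (λ i → f (suc i))))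
                          (sym (neg-distrib-+ (f zero) _))

∑-distrib-- : ∀ n (f g : Fin n → ℚ) → ∑ n (λ i → f i - g i) ≡ ∑ n f - ∑ n g
∑-distrib-- n f g = trans (∑-distrib-+ n f (λ i → - g i)) (cong (∑ n f +_) (∑-neg n g))

∑-mono-≤ : ∀ n {f g : Fin n → ℚ} → (∀ i → f i ≤ g i) → ∑ n f ≤ ∑ n g
∑-mono-≤ ℕ.zero    f≤g = ≤-refl
∑-mono-≤ (ℕ.suc n) f≤g = +-mono-≤ (f≤g zero) (∑-mono-≤ n (λ i → f≤g (suc i)))

0≤∑ : ∀ n {f : Fin n → ℚ} → (∀ i → 0ℚ ≤ f i) → 0ℚ ≤ ∑ n f
0≤∑ n 0≤f = subst (_≤ ∑ n _) (∑-zero n) (∑-mono-≤ n 0≤f)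

∑-[≟] : ∀ n (j : Fin n) (f : Fin n → ℚ) → ∑ n (λ i → [ j ≟F i ] * f i) ≡ f j
∑-[≟] (ℕ.suc n) zero f = begin
  1ℚ * f zero + ∑ n (λ i → 0ℚ * f (suc i))  ≡⟨ cong₂ _+_ (*-identityˡ (f zero)) (∑-cong n (λ i → *-zeroˡ (f (suc i)))) ⟩
  f zero + ∑ n (λ _ → 0ℚ)                   ≡⟨ cong (f zero +_) (∑-zero n) ⟩
  f zero + 0ℚ                               ≡⟨ +-identityʳ _ ⟩
  f zero                                    ∎
  where open ≡-Reasoning
∑-[≟] (ℕ.suc n) (suc j) f = begin
  0ℚ * f zero + ∑ n (λ i → [ suc j ≟F suc i ] * f (suc i))  ≡⟨ cong₂ _+_ (*-zeroˡ (f zero)) (∑-cong n suc-≟) ⟩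
  0ℚ + ∑ n (λ i → [ j ≟F i ] * f (suc i))                   ≡⟨ +-identityˡ _ ⟩
  ∑ n (λ i → [ j ≟F i ] * f (suc i))                        ≡⟨ ∑-[≟] n j (λ i → f (suc i)) ⟩
  f (suc j)                                                 ∎
  where
  open ≡-Reasoning
  suc-≟ : ∀ i → [ suc j ≟F suc i ] * f (suc i) ≡ [ j ≟F i ] * f (suc i)
  suc-≟ i = cong (_* f (suc i)) ([]-⇔ (suc j ≟F suc i) (j ≟F i) Fin.suc-injective (cong suc))

∑-[≟]′ : ∀ n (j : Fin n) (f : Fin n → ℚ) → ∑ n (λ i → [ i ≟F j ] * f i) ≡ f j
∑-[≟]′ n j f = trans (∑-cong n (λ i → cong (_* f i) ([]-⇔ (i ≟F j) (j ≟F i) sym sym))) (∑-[≟] n j f)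

ℕ→ℚ-∑ℕ : ∀ n (f : Fin n → ℕ) → ℕ→ℚ (∑ℕ n f) ≡ ∑ n (λ i → ℕ→ℚ (f i))
ℕ→ℚ-∑ℕ ℕ.zero    f = refl
ℕ→ℚ-∑ℕ (ℕ.suc n) f = trans (ℕ→ℚ-homo-+ (f zero) _) (cong (ℕ→ℚ (f zero) +_) (ℕ→ℚ-∑ℕ n _))

∑ℕ-≥-term : ∀ n (f : Fin n → ℕ) j → f j ℕ.≤ ∑ℕ n f
∑ℕ-≥-term (ℕ.suc n) f zero    = ℕ.m≤m+n (f zero) _
∑ℕ-≥-term (ℕ.suc n) f (suc j) = ℕ.≤-trans (∑ℕ-≥-term n (λ i → f (suc i)) j) (ℕ.m≤n+m _ (f zero))

ℕ→ℚ-∑ℕ-[] : ∀ n {P : Fin n → Set} (d : ∀ i → Dec (P i)) (f : Fin n → ℕ) →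
             ℕ→ℚ (∑ℕ n (λ i → [ d i ]ℕ ℕ.* f i)) ≡ ∑ n (λ i → [ d i ] * ℕ→ℚ (f i))
ℕ→ℚ-∑ℕ-[] n d f = trans (ℕ→ℚ-∑ℕ n _)
  (∑-cong n (λ i → trans (ℕ→ℚ-homo-* [ d i ]ℕ (f i)) (cong (_* ℕ→ℚ (f i)) ([]ℕ→ℚ (d i)))))

∑ℕ-mono-≤ : ∀ n {f g : Fin n → ℕ} → (∀ i → f i ℕ.≤ g i) → ∑ℕ n f ℕ.≤ ∑ℕ n g
∑ℕ-mono-≤ ℕ.zero    f≤g = ℕ.z≤n
∑ℕ-mono-≤ (ℕ.suc n) f≤g = ℕ.+-mono-≤ (f≤g zero) (∑ℕ-mono-≤ n (λ i → f≤g (suc i)))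

∑L-cong : ∀ {A : Set} (xs : List A) {f g : A → ℚ} → (∀ x → f x ≡ g x) → ∑L xs f ≡ ∑L xs g
∑L-cong []       f≗g = refl
∑L-cong (x ∷ xs) f≗g = cong₂ _+_ (f≗g x) (∑L-cong xs f≗g)

∑L-distrib-+ : ∀ {A : Set} (xs : List A) (f g : A → ℚ) →
               ∑L xs (λ x → f x + g x) ≡ ∑L xs f + ∑L xs g
∑L-distrib-+ []       f g = sym (+-identityʳ 0ℚ)
∑L-distrib-+ (x ∷ xs) f g = trans (cong (f x + g x +_) (∑L-distrib-+ xs f g))
                                  (+-exchange (f x) (g x) (∑L xs f) (∑L xs g))
  where
  open +-*-Solver
  +-exchange : ∀ a b c d → a + b + (c + d) ≡ a + c + (b + d)
  +-exchange = solve 4 (λ a b c d → a :+ b :+ (c :+ d) := a :+ c :+ (b :+ d)) refl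

*-distribˡ-∑L : ∀ {A : Set} (xs : List A) c (f : A → ℚ) → c * ∑L xs f ≡ ∑L xs (λ x → c * f x)
*-distribˡ-∑L []       c f = *-zeroʳ c
*-distribˡ-∑L (x ∷ xs) c f = trans (*-distribˡ-+ c (f x) _) (cong (c * f x +_) (*-distribˡ-∑L xs c f))

∑L-neg : ∀ {A : Set} (xs : List A) (f : A → ℚ) → ∑L xs (λ x → - f x) ≡ - ∑L xs f
∑L-neg []       f = refl
∑L-neg (x ∷ xs) f = trans (cong (- f x +_) (∑L-neg xs f)) (sym (neg-distrib-+ (f x) _))

∑L-∑-comm : ∀ {A : Set} (xs : List A) n (f : A → Fin n → ℚ) →
            ∑L xs (λ x → ∑ n (f x)) ≡ ∑ n (λ i → ∑L xs (λ x → f x i))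
∑L-∑-comm []       n f = sym (∑-zero n)
∑L-∑-comm (x ∷ xs) n f = trans (cong (∑ n (f x) +_) (∑L-∑-comm xs n f))
                               (sym (∑-distrib-+ n (f x) _))

∑L-map : ∀ {A B : Set} (g : A → B) (xs : List A) (f : B → ℚ) → ∑L (map g xs) f ≡ ∑L xs (λ x → f (g x))
∑L-map g []       f = refl
∑L-map g (x ∷ xs) f = cong (f (g x) +_) (∑L-map g xs f)

∑L-mono-≤ : ∀ {A : Set} (xs : List A) {f g : A → ℚ} → All (λ x → f x ≤ g x) xs → ∑L xs f ≤ ∑L xs g
∑L-mono-≤ []       []           = ≤-refl
∑L-mono-≤ (x ∷ xs) (fx≤gx ∷ le) = +-mono-≤ fx≤gx (∑L-mono-≤ xs le)

module _ (G : Graph) where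
  open Graph G

  flowAt : (Arc G → Fin n) → (Arc G → ℚ) → Fin n → ℚ
  flowAt end z u = ∑ m (λ e → [ end (e , true) ≟F u ] * z (e , true) + [ end (e , false) ≟F u ] * z (e , false))

  outflowOf inflowOf : (Arc G → ℚ) → Fin n → ℚ
  outflowOf = flowAt (tail G)
  inflowOf  = flowAt (head G)

  flowAt-*ˡ : ∀ end c z u → flowAt end (λ a → c * z a) u ≡ c * flowAt end z u
  flowAt-*ˡ end c z u = trans (∑-cong m (λ e → pull-out [ end (e , true) ≟F u ] [ end (e , false) ≟F u ] c (z (e , true)) (z (e , false))))
                              (sym (*-distribˡ-∑ m c _))
    where
    open +-*-Solver
    pull-out : ∀ x y c a b → x * (c * a) + y * (c * b) ≡ c * (x * a + y * b)
    pull-out = solve 5 (λ x y c a b → x :* (c :* a) :+ y :* (c :* b) := c :* (x :* a :+ y :* b)) refl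

  flowAt-+ : ∀ end z z′ u → flowAt end (λ a → z a + z′ a) u ≡ flowAt end z u + flowAt end z′ u
  flowAt-+ end z z′ u = trans (∑-cong m (λ e → regroup [ end (e , true) ≟F u ] [ end (e , false) ≟F u ]
                                                      (z (e , true)) (z (e , false)) (z′ (e , true)) (z′ (e , false))))
                              (∑-distrib-+ m _ _)
    where
    open +-*-Solver
    regroup : ∀ x y a b a′ b′ → x * (a + a′) + y * (b + b′) ≡ (x * a + y * b) + (x * a′ + y * b′)
    regroup = solve 6 (λ x y a b a′ b′ → x :* (a :+ a′) :+ y :* (b :+ b′) := (x :* a :+ y :* b) :+ (x :* a′ :+ y :* b′)) refl

  flowAt-∑L : ∀ {A : Set} end (xs : List A) (z : A → Arc G → ℚ) u →
              flowAt end (λ a → ∑L xs (λ x → z x a)) u ≡ ∑L xs (λ x → flowAt end (z x) u)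
  flowAt-∑L end xs z u = trans (∑-cong m per-edge) (sym (∑L-∑-comm xs m _))
    where
    per-edge : ∀ e → [ end (e , true) ≟F u ] * ∑L xs (λ x → z x (e , true)) + [ end (e , false) ≟F u ] * ∑L xs (λ x → z x (e , false))
                   ≡ ∑L xs (λ x → [ end (e , true) ≟F u ] * z x (e , true) + [ end (e , false) ≟F u ] * z x (e , false))
    per-edge e = trans (cong₂ _+_ (*-distribˡ-∑L xs [ end (e , true) ≟F u ] (λ x → z x (e , true)))
                                  (*-distribˡ-∑L xs [ end (e , false) ≟F u ] (λ x → z x (e , false))))
                       (sym (∑L-distrib-+ xs (λ x → [ end (e , true) ≟F u ] * z x (e , true))
                                             (λ x → [ end (e , false) ≟F u ] * z x (e , false))))

  ∑-flowAt : ∀ end z → ∑ n (flowAt end z) ≡ ∑ m (λ e → z (e , true) + z (e , false))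
  ∑-flowAt end z = trans (∑-comm n m _) (∑-cong m per-edge)
    where
    per-edge : ∀ e → ∑ n (λ u → [ end (e , true) ≟F u ] * z (e , true) + [ end (e , false) ≟F u ] * z (e , false))
                   ≡ z (e , true) + z (e , false)
    per-edge e = trans (∑-distrib-+ n _ _)
                       (cong₂ _+_ (∑-[≟] n (end (e , true)) (λ _ → z (e , true)))
                                  (∑-[≟] n (end (e , false)) (λ _ → z (e , false))))

  0≤flowAt : ∀ end {z} u → (∀ a → 0ℚ ≤ z a) → 0ℚ ≤ flowAt end z u
  0≤flowAt end u 0≤z = 0≤∑ m (λ e → +-mono-≤ {0ℚ} {_} {0ℚ}
    (0≤* (0≤[] (end (e , true) ≟F u)) (0≤z (e , true))) (0≤* (0≤[] (end (e , false) ≟F u)) (0≤z (e , false))))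

  flowAt-[≟] : ∀ end e₀ b₀ u → flowAt end (λ a → [ proj₁ a ≟F e₀ ] * [ proj₂ a ≟B b₀ ]) u ≡ [ end (e₀ , b₀) ≟F u ]
  flowAt-[≟] end e₀ b₀ u = trans (∑-cong m factor) (trans (∑-[≟]′ m e₀ at) (at-b₀ b₀))
    where
    open +-*-Solver
    at : Fin m → ℚ
    at e = [ end (e , true) ≟F u ] * [ true ≟B b₀ ] + [ end (e , false) ≟F u ] * [ false ≟B b₀ ]
    factor : ∀ e → [ end (e , true) ≟F u ] * ([ e ≟F e₀ ] * [ true ≟B b₀ ]) + [ end (e , false) ≟F u ] * ([ e ≟F e₀ ] * [ false ≟B b₀ ])
                 ≡ [ e ≟F e₀ ] * at e
    factor e = solve 5 (λ x y i p q → x :* (i :* p) :+ y :* (i :* q) := i :* (x :* p :+ y :* q)) refl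
                 [ end (e , true) ≟F u ] [ end (e , false) ≟F u ] [ e ≟F e₀ ] [ true ≟B b₀ ] [ false ≟B b₀ ]
    at-b₀ : ∀ b₀ → [ end (e₀ , true) ≟F u ] * [ true ≟B b₀ ] + [ end (e₀ , false) ≟F u ] * [ false ≟B b₀ ] ≡ [ end (e₀ , b₀) ≟F u ]
    at-b₀ true  = solve 2 (λ x y → x :* con 1ℚ :+ y :* con 0ℚ := x) refl [ end (e₀ , true) ≟F u ] [ end (e₀ , false) ≟F u ]
    at-b₀ false = solve 2 (λ x y → x :* con 0ℚ :+ y :* con 1ℚ := y) refl [ end (e₀ , true) ≟F u ] [ end (e₀ , false) ≟F u ]

  occurrences : List (Arc G) → Arc G → ℚ
  occurrences as a = ℕ→ℚ (count G a as)

  occurrences-∷ : ∀ e₀ b₀ as e b →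
                  occurrences ((e₀ , b₀) ∷ as) (e , b) ≡ [ e ≟F e₀ ] * [ b ≟B b₀ ] + occurrences as (e , b)
  occurrences-∷ e₀ b₀ as e b with e ≟F e₀ | b ≟B b₀
  ... | yes _ | yes _ = trans (ℕ→ℚ-homo-+ 1 (count G (e , b) as)) (cong (_+ occurrences as (e , b)) (sym (*-identityˡ 1ℚ)))
  ... | yes _ | no _  = sym (trans (cong (_+ occurrences as (e , b)) (*-zeroʳ 1ℚ)) (+-identityˡ _))
  ... | no _  | yes _ = sym (trans (cong (_+ occurrences as (e , b)) (*-zeroˡ 1ℚ)) (+-identityˡ _))
  ... | no _  | no _  = sym (trans (cong (_+ occurrences as (e , b)) (*-zeroˡ 0ℚ)) (+-identityˡ _))

  flowAt-occurrences-∷ : ∀ end a₀ as u → flowAt end (occurrences (a₀ ∷ as)) u ≡ [ end a₀ ≟F u ] + flowAt end (occurrences as) u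
  flowAt-occurrences-∷ end (e₀ , b₀) as u = begin
    flowAt end (occurrences ((e₀ , b₀) ∷ as)) u
      ≡⟨ ∑-cong m (λ e → cong₂ _+_ (cong ([ end (e , true) ≟F u ] *_) (occurrences-∷ e₀ b₀ as e true))
                                   (cong ([ end (e , false) ≟F u ] *_) (occurrences-∷ e₀ b₀ as e false))) ⟩
    flowAt end (λ a → [ proj₁ a ≟F e₀ ] * [ proj₂ a ≟B b₀ ] + occurrences as a) u
      ≡⟨ flowAt-+ end (λ a → [ proj₁ a ≟F e₀ ] * [ proj₂ a ≟B b₀ ]) (occurrences as) u ⟩
    flowAt end (λ a → [ proj₁ a ≟F e₀ ] * [ proj₂ a ≟B b₀ ]) u + flowAt end (occurrences as) u
      ≡⟨ cong (_+ flowAt end (occurrences as) u) (flowAt-[≟] end e₀ b₀ u) ⟩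
    [ end (e₀ , b₀) ≟F u ] + flowAt end (occurrences as) u  ∎
    where open ≡-Reasoning

  walk-balance : ∀ {a as b} → IsWalk G a as b → ∀ u →
                 outflowOf (occurrences as) u - inflowOf (occurrences as) u ≡ [ a ≟F u ] - [ b ≟F u ]
  walk-balance {a} nil u = begin
    outflowOf (occurrences []) u - inflowOf (occurrences []) u  ≡⟨ cong₂ _-_ (nothing (tail G)) (nothing (head G)) ⟩
    0ℚ - 0ℚ                                                     ≡⟨ +-inverseʳ [ a ≟F u ] ⟨
    [ a ≟F u ] - [ a ≟F u ]                                     ∎
    where
    open ≡-Reasoning
    nothing : ∀ end → flowAt end (occurrences []) u ≡ 0ℚ
    nothing end = trans (∑-cong m (λ e → cong₂ _+_ (*-zeroʳ [ end (e , true) ≟F u ]) (*-zeroʳ [ end (e , false) ≟F u ])))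
                        (∑-zero m)
  walk-balance {b = b} (cons {a = a₀} {as} refl w) u = begin
    outflowOf (occurrences (a₀ ∷ as)) u - inflowOf (occurrences (a₀ ∷ as)) u
      ≡⟨ cong₂ _-_ (flowAt-occurrences-∷ (tail G) a₀ as u) (flowAt-occurrences-∷ (head G) a₀ as u) ⟩
    ([ tail G a₀ ≟F u ] + O) - ([ head G a₀ ≟F u ] + I)
      ≡⟨ telescope [ tail G a₀ ≟F u ] [ head G a₀ ≟F u ] O I ⟩
    [ tail G a₀ ≟F u ] + ((O - I) - [ head G a₀ ≟F u ])
      ≡⟨ cong (λ d → [ tail G a₀ ≟F u ] + (d - [ head G a₀ ≟F u ])) (walk-balance w u) ⟩
    [ tail G a₀ ≟F u ] + (([ head G a₀ ≟F u ] - [ b ≟F u ]) - [ head G a₀ ≟F u ])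
      ≡⟨ cancel [ tail G a₀ ≟F u ] [ head G a₀ ≟F u ] [ b ≟F u ] ⟩
    [ tail G a₀ ≟F u ] - [ b ≟F u ]  ∎
    where
    open ≡-Reasoning
    open +-*-Solver
    O : ℚ
    O = outflowOf (occurrences as) u
    I : ℚ
    I = inflowOf (occurrences as) u
    telescope : ∀ t h o i → (t + o) - (h + i) ≡ t + ((o - i) - h)
    telescope = solve 4 (λ t h o i → (t :+ o) :- (h :+ i) := t :+ ((o :- i) :- h)) refl
    cancel : ∀ t h b → t + ((h - b) - h) ≡ t - b
    cancel = solve 3 (λ t h b → t :+ ((h :- b) :- h) := t :- b) refl

  walk-outflow≥ : ∀ {a as b} → IsWalk G a as b → a ≢ b → ∀ u → [ a ≟F u ] ≤ outflowOf (occurrences as) u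
  walk-outflow≥ nil                          a≢a _ = ⊥-elim (a≢a refl)
  walk-outflow≥ (cons {a = a₀} {as} refl w) _   u = begin
    [ tail G a₀ ≟F u ]                                    ≡⟨ +-identityʳ _ ⟨
    [ tail G a₀ ≟F u ] + 0ℚ                               ≤⟨ +-monoʳ-≤ [ tail G a₀ ≟F u ] (0≤flowAt (tail G) u (λ a → 0≤ℕ→ℚ (count G a as))) ⟩
    [ tail G a₀ ≟F u ] + outflowOf (occurrences as) u     ≡⟨ flowAt-occurrences-∷ (tail G) a₀ as u ⟨
    outflowOf (occurrences (a₀ ∷ as)) u                   ∎
    where open ≤-Reasoning

  IsWalk-++ : ∀ {u v w as bs} → IsWalk G u as v → IsWalk G v bs w → IsWalk G u (as ++ bs) w
  IsWalk-++ nil           w₂ = w₂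
  IsWalk-++ (cons t≡ w₁) w₂ = cons t≡ (IsWalk-++ w₁ w₂)

  count-∉ : ∀ a as → All (head G a ≢_) (map (head G) as) → count G a as ≡ 0
  count-∉ a              []             _              = refl
  count-∉ (e , b) ((e₀ , b₀) ∷ as) (h≢ ∷ h∉) with e ≟F e₀ | b ≟B b₀
  ... | yes refl | yes refl = ⊥-elim (h≢ refl)
  ... | yes _    | no _     = count-∉ (e , b) as h∉
  ... | no _     | yes _    = count-∉ (e , b) as h∉
  ... | no _     | no _     = count-∉ (e , b) as h∉

  count≤1 : ∀ a as → Unique (map (head G) as) → count G a as ℕ.≤ 1
  count≤1 a              []             _            = ℕ.z≤n
  count≤1 (e , b) ((e₀ , b₀) ∷ as) (h∉ ∷ distinct) with e ≟F e₀ | b ≟B b₀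
  ... | yes refl | yes refl = ℕ.s≤s (ℕ.≤-reflexive (count-∉ (e , b) as h∉))
  ... | yes _    | no _     = count≤1 (e , b) as distinct
  ... | no _     | yes _    = count≤1 (e , b) as distinct
  ... | no _     | no _     = count≤1 (e , b) as distinct

  path-occurrences≤1 : ∀ {u as v} → IsPath G u as v → ∀ a → occurrences as a ≤ 1ℚ
  path-occurrences≤1 {as = as} (_ , _ ∷ distinct) a = ℕ→ℚ-mono-≤ {count G a as} {1} (count≤1 a as distinct)

module Columns (I : Instance) (π : Partition (Graph.n (Instance.Gr I))) where
  open Instance I
  open Partition π
  open VPF I π

  Column : Set
  Column = {j : Fin k} → Mapping j → ℚ

  pathFlow : {j : Fin k} → Mapping j → Fin er → Arc Gs → ℚ
  pathFlow m ē = occurrences Gs (Mapping.mE m ē)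

  nodeCost : {j : Fin k} → Mapping j → Fin nr → ℚ
  nodeCost m x = ℕ→ℚ (dV x ℕ.* wV (Mapping.mV m x))

  arcCost : Fin er → Fin es → ℚ
  arcCost ē e = ℕ→ℚ (wE e ℕ.* dE ē)

  pathCost : {j : Fin k} → Mapping j → Fin er → ℚ
  pathCost m ē = ∑ es (λ e → arcCost ē e * (pathFlow m ē (e , true) + pathFlow m ē (e , false)))

  ℕ→ℚ-mcost : ∀ {j} (m : Mapping j) →
    ℕ→ℚ (mcost m) ≡ ∑ nr (λ x → [ part x ≟F j ] * nodeCost m x) + ∑ er (λ ē → [ edgeIn? j ē ] * pathCost m ē)
  ℕ→ℚ-mcost {j} m = trans (ℕ→ℚ-homo-+ (∑ℕ nr (λ x → [ part x ≟F j ]ℕ ℕ.* nodeCostℕ x)) (∑ℕ er (λ ē → [ edgeIn? j ē ]ℕ ℕ.* pathCostℕ ē)))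
    (cong₂ _+_ (ℕ→ℚ-∑ℕ-[] nr (λ x → part x ≟F j) nodeCostℕ)
               (trans (ℕ→ℚ-∑ℕ-[] er (λ ē → edgeIn? j ē) pathCostℕ) (∑-cong er (λ ē → cong ([ edgeIn? j ē ] *_) (path ē)))))
    where
    open ≡-Reasoning
    nodeCostℕ : Fin nr → ℕ
    nodeCostℕ x = dV x ℕ.* wV (Mapping.mV m x)
    pathCostℕ : Fin er → ℕ
    pathCostℕ ē = ∑ℕ es (λ e → (Y m ē (e , true) ℕ.+ Y m ē (e , false)) ℕ.* (dE ē ℕ.* wE e))
    path : ∀ ē → ℕ→ℚ (pathCostℕ ē) ≡ pathCost m ē
    path ē = trans (ℕ→ℚ-∑ℕ es _) (∑-cong es (λ e → begin
      ℕ→ℚ ((Y m ē (e , true) ℕ.+ Y m ē (e , false)) ℕ.* (dE ē ℕ.* wE e))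
        ≡⟨ ℕ→ℚ-homo-* (Y m ē (e , true) ℕ.+ Y m ē (e , false)) (dE ē ℕ.* wE e) ⟩
      ℕ→ℚ (Y m ē (e , true) ℕ.+ Y m ē (e , false)) * ℕ→ℚ (dE ē ℕ.* wE e)
        ≡⟨ cong₂ _*_ (ℕ→ℚ-homo-+ (Y m ē (e , true)) (Y m ē (e , false))) (cong ℕ→ℚ (ℕ.*-comm (dE ē) (wE e))) ⟩
      (pathFlow m ē (e , true) + pathFlow m ē (e , false)) * arcCost ē e
        ≡⟨ *-comm _ (arcCost ē e) ⟩
      arcCost ē e * (pathFlow m ē (e , true) + pathFlow m ē (e , false))  ∎))

  ℕ→ℚ-edgeLoad : ∀ {j} (m : Mapping j) e →
    ℕ→ℚ (edgeLoad m e) ≡ ∑ er (λ ē → [ edgeIn? j ē ] * (ℕ→ℚ (dE ē) * (pathFlow m ē (e , true) + pathFlow m ē (e , false))))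
  ℕ→ℚ-edgeLoad {j} m e = trans (ℕ→ℚ-∑ℕ-[] er (λ ē → edgeIn? j ē) _) (∑-cong er (λ ē → cong ([ edgeIn? j ē ] *_)
    (trans (ℕ→ℚ-homo-* (dE ē) _) (cong (ℕ→ℚ (dE ē) *_) (trans (ℕ→ℚ-homo-+ (Y m ē (e , false)) (Y m ē (e , true)))
                                                             (+-comm (pathFlow m ē (e , false)) (pathFlow m ē (e , true))))))))

  same-part : ∀ ē → ¬ Cut ē → part (rs ē) ≡ part (rt ē)
  same-part ē = decidable-stable (part (rs ē) ≟F part (rt ē))

  ∑-[edgeIn] : ∀ ē (G : Fin k → ℚ) → ∑ k (λ i → [ edgeIn? i ē ] * G i) ≡ (if does (cut? ē) then 0ℚ else G (part (rs ē)))
  ∑-[edgeIn] ē G = by-cut (cut? ē)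
    where
    by-cut : (d : Dec (Cut ē)) → ∑ k (λ i → [ edgeIn? i ē ] * G i) ≡ (if does d then 0ℚ else G (part (rs ē)))
    by-cut (yes cut) = trans (∑-cong k nowhere) (∑-zero k)
      where
      nowhere : ∀ i → [ edgeIn? i ē ] * G i ≡ 0ℚ
      nowhere i with edgeIn? i ē
      ... | yes (s∈i , t∈i) = ⊥-elim (cut (trans s∈i (sym t∈i)))
      ... | no _             = *-zeroˡ (G i)
    by-cut (no uncut) = trans (∑-cong k (λ i → cong (_* G i) ([]-⇔ (edgeIn? i ē) (part (rs ē) ≟F i) proj₁ both-in)))
                              (∑-[≟] k (part (rs ē)) G)
      where
      both-in : ∀ {i} → part (rs ē) ≡ i → edgeIn i ē
      both-in s∈i = s∈i , trans (sym (same-part ē uncut)) s∈i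

  module _ (S : Solution) where
    open Solution S

    totalWeight : Fin k → ℚ
    totalWeight i = ∑L (lam i) proj₂

    ∑λ-cong : ∀ i (f g : Column) → (∀ (m : FeasMapping i) → f (proj₁ m) ≡ g (proj₁ m)) → ∑λ S i f ≡ ∑λ S i g
    ∑λ-cong i f g f≗g = ∑L-cong (lam i) (λ c → cong (_* proj₂ c) (f≗g (proj₁ c)))

    ∑λ-distrib-+ : ∀ i (f g : Column) → ∑λ S i (λ m → f m + g m) ≡ ∑λ S i f + ∑λ S i g
    ∑λ-distrib-+ i f g = trans (∑L-cong (lam i) (λ c → *-distribʳ-+ (proj₂ c) (f (proj₁ (proj₁ c))) (g (proj₁ (proj₁ c)))))
                               (∑L-distrib-+ (lam i) _ _)

    *-distribˡ-∑λ : ∀ i c (f : Column) → c * ∑λ S i f ≡ ∑λ S i (λ m → c * f m)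
    *-distribˡ-∑λ i c f = trans (*-distribˡ-∑L (lam i) c _)
                                (∑L-cong (lam i) (λ col → sym (*-assoc c (f (proj₁ (proj₁ col))) (proj₂ col))))

    ∑λ-distrib-- : ∀ i (f g : Column) → ∑λ S i (λ m → f m - g m) ≡ ∑λ S i f - ∑λ S i g
    ∑λ-distrib-- i f g = begin
      ∑λ S i (λ m → f m - g m)       ≡⟨ ∑λ-distrib-+ i f (λ m → - g m) ⟩
      ∑λ S i f + ∑λ S i (λ m → - g m) ≡⟨ cong (∑λ S i f +_) (trans (∑L-cong (lam i) (λ c → sym (neg-distribˡ-* (g (proj₁ (proj₁ c))) (proj₂ c))))
                                                                   (∑L-neg (lam i) _)) ⟩
      ∑λ S i f - ∑λ S i g             ∎
      where open ≡-Reasoning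

    ∑λ-∑-comm : ∀ i n (h : {j : Fin k} → Mapping j → Fin n → ℚ) →
                ∑λ S i (λ m → ∑ n (h m)) ≡ ∑ n (λ x → ∑λ S i (λ m → h m x))
    ∑λ-∑-comm i n h = trans (∑L-cong (lam i) (λ c → trans (*-comm (∑ n (h (proj₁ (proj₁ c)))) (proj₂ c))
                                                           (*-distribˡ-∑ n (proj₂ c) (h (proj₁ (proj₁ c))))))
                            (trans (∑L-∑-comm (lam i) n _)
                                   (∑-cong n (λ x → ∑L-cong (lam i) (λ c → *-comm (proj₂ c) (h (proj₁ (proj₁ c)) x)))))

    ∑λ-const : ∀ i c → ∑λ S i (λ _ → c) ≡ c * totalWeight i
    ∑λ-const i c = sym (*-distribˡ-∑L (lam i) c proj₂)

    flowAt-∑λ : ∀ i end (z : {j : Fin k} → Mapping j → Arc Gs → ℚ) u →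
                flowAt Gs end (λ a → ∑λ S i (λ m → z m a)) u ≡ ∑λ S i (λ m → flowAt Gs end (z m) u)
    flowAt-∑λ i end z u = trans (flowAt-∑L Gs end (lam i) (λ c a → z (proj₁ (proj₁ c)) a * proj₂ c) u)
                                (∑L-cong (lam i) (λ c → trans (flowAt-cong (λ a → *-comm (z (proj₁ (proj₁ c)) a) (proj₂ c)))
                                                        (trans (flowAt-*ˡ Gs end (proj₂ c) (z (proj₁ (proj₁ c))) u)
                                                               (*-comm (proj₂ c) _))))
      where
      flowAt-cong : ∀ {z z′ : Arc Gs → ℚ} → (∀ a → z a ≡ z′ a) → flowAt Gs end z u ≡ flowAt Gs end z′ u
      flowAt-cong z≗z′ = ∑-cong es (λ e → cong₂ _+_ (cong ([ end (e , true) ≟F u ] *_) (z≗z′ (e , true)))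
                                                    (cong ([ end (e , false) ≟F u ] *_) (z≗z′ (e , false))))

    module _ (0≤λ≤1 : ∀ i → All (λ c → 0ℚ ≤ proj₂ c × proj₂ c ≤ 1ℚ) (lam i)) where

      ∑λ-mono-≤ : ∀ i (f g : Column) → (∀ (m : FeasMapping i) → f (proj₁ m) ≤ g (proj₁ m)) → ∑λ S i f ≤ ∑λ S i g
      ∑λ-mono-≤ i f g f≤g = ∑L-mono-≤ (lam i) (All.map (λ {c} w → *-monoʳ-≤-nonNeg (proj₂ c) {{nonNegative (proj₁ w)}} (f≤g (proj₁ c)))
                                                   (0≤λ≤1 i))

      0≤∑λ : ∀ i (f : Column) → (∀ (m : FeasMapping i) → 0ℚ ≤ f (proj₁ m)) → 0ℚ ≤ ∑λ S i f
      0≤∑λ i f 0≤f = subst (_≤ ∑λ S i f) (trans (∑λ-const i 0ℚ) (*-zeroˡ (totalWeight i))) (∑λ-mono-≤ i (λ _ → 0ℚ) f 0≤f)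

    -- Lemmas about arcFlow generalise cut? ē to an arbitrary decision d, on
    -- which the conditional then reduces.
    arcFlow : Fin er → Arc Gs → ℚ
    arcFlow ē a = if does (cut? ē) then y ē a else ∑λ S (part (rs ē)) (λ m → pathFlow m ē a)

    ∑-parts-nodes : (g : {j : Fin k} → Mapping j → Fin nr → ℚ) →
      ∑ k (λ i → ∑λ S i (λ {j} m → ∑ nr (λ x → [ part x ≟F j ] * g m x))) ≡ ∑ nr (λ x → ∑λ S (part x) (λ m → g m x))
    ∑-parts-nodes g = begin
      ∑ k (λ i → ∑λ S i (λ {j} m → ∑ nr (λ x → [ part x ≟F j ] * g m x)))
        ≡⟨ ∑-cong k (λ i → trans (∑λ-∑-comm i nr (λ {j} m x → [ part x ≟F j ] * g m x))
                                 (∑-cong nr (λ x → sym (*-distribˡ-∑λ i [ part x ≟F i ] (λ m → g m x))))) ⟩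
      ∑ k (λ i → ∑ nr (λ x → [ part x ≟F i ] * ∑λ S i (λ m → g m x)))
        ≡⟨ ∑-comm k nr _ ⟩
      ∑ nr (λ x → ∑ k (λ i → [ part x ≟F i ] * ∑λ S i (λ m → g m x)))
        ≡⟨ ∑-cong nr (λ x → ∑-[≟] k (part x) (λ i → ∑λ S i (λ m → g m x))) ⟩
      ∑ nr (λ x → ∑λ S (part x) (λ m → g m x))  ∎
      where open ≡-Reasoning

    ∑-parts-edges : (g : {j : Fin k} → Mapping j → Fin er → ℚ) →
      ∑ k (λ i → ∑λ S i (λ {j} m → ∑ er (λ ē → [ edgeIn? j ē ] * g m ē)))
        ≡ ∑ er (λ ē → if does (cut? ē) then 0ℚ else ∑λ S (part (rs ē)) (λ m → g m ē))
    ∑-parts-edges g = begin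
      ∑ k (λ i → ∑λ S i (λ {j} m → ∑ er (λ ē → [ edgeIn? j ē ] * g m ē)))
        ≡⟨ ∑-cong k (λ i → trans (∑λ-∑-comm i er (λ {j} m ē → [ edgeIn? j ē ] * g m ē))
                                 (∑-cong er (λ ē → sym (*-distribˡ-∑λ i [ edgeIn? i ē ] (λ m → g m ē))))) ⟩
      ∑ k (λ i → ∑ er (λ ē → [ edgeIn? i ē ] * ∑λ S i (λ m → g m ē)))
        ≡⟨ ∑-comm k er _ ⟩
      ∑ er (λ ē → ∑ k (λ i → [ edgeIn? i ē ] * ∑λ S i (λ m → g m ē)))
        ≡⟨ ∑-cong er (λ ē → ∑-[edgeIn] ē (λ i → ∑λ S i (λ m → g m ē))) ⟩
      ∑ er (λ ē → if does (cut? ē) then 0ℚ else ∑λ S (part (rs ē)) (λ m → g m ē))  ∎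
      where open ≡-Reasoning

    ∑λ-*-distrib-+ : ∀ i c (f g : Column) → ∑λ S i (λ m → c * (f m + g m)) ≡ c * (∑λ S i f + ∑λ S i g)
    ∑λ-*-distrib-+ i c f g = trans (sym (*-distribˡ-∑λ i c (λ m → f m + g m))) (cong (c *_) (∑λ-distrib-+ i f g))

    edgeLoad-by-edge : ∀ e →
      ∑ k (λ i → ∑λ S i (λ mp → ℕ→ℚ (edgeLoad mp e)))
        + ∑ er (λ ē → [ cut? ē ] * (ℕ→ℚ (dE ē) * (y ē (e , true) + y ē (e , false))))
      ≡ ∑ er (λ ē → ℕ→ℚ (dE ē) * (arcFlow ē (e , true) + arcFlow ē (e , false)))
    edgeLoad-by-edge e = begin
      ∑ k (λ i → ∑λ S i (λ mp → ℕ→ℚ (edgeLoad mp e))) + ∑ er cutLoad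
        ≡⟨ cong (_+ ∑ er cutLoad) (trans (∑-cong k (λ i → ∑λ-cong i (λ mp → ℕ→ℚ (edgeLoad mp e)) perEdgeLoad (λ m → ℕ→ℚ-edgeLoad (proj₁ m) e)))
                                         (∑-parts-edges (λ m ē → D ē * (pathFlow m ē (e , true) + pathFlow m ē (e , false))))) ⟩
      ∑ er internalLoad + ∑ er cutLoad
        ≡⟨ sym (∑-distrib-+ er internalLoad cutLoad) ⟩
      ∑ er (λ ē → internalLoad ē + cutLoad ē)
        ≡⟨ ∑-cong er (λ ē → by-cut ē (cut? ē)) ⟩
      ∑ er (λ ē → D ē * (arcFlow ē (e , true) + arcFlow ē (e , false)))  ∎
      where
      open ≡-Reasoning
      D : Fin er → ℚ
      D ē = ℕ→ℚ (dE ē)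
      cutLoad internalLoad : Fin er → ℚ
      cutLoad ē = [ cut? ē ] * (D ē * (y ē (e , true) + y ē (e , false)))
      internalLoad ē = if does (cut? ē) then 0ℚ else ∑λ S (part (rs ē)) (λ m → D ē * (pathFlow m ē (e , true) + pathFlow m ē (e , false)))
      perEdgeLoad : Column
      perEdgeLoad {j} m = ∑ er (λ ē → [ edgeIn? j ē ] * (D ē * (pathFlow m ē (e , true) + pathFlow m ē (e , false))))
      by-cut : ∀ ē (d : Dec (Cut ē)) →
        (if does d then 0ℚ else ∑λ S (part (rs ē)) (λ m → D ē * (pathFlow m ē (e , true) + pathFlow m ē (e , false))))
          + [ d ] * (D ē * (y ē (e , true) + y ē (e , false)))
        ≡ D ē * ((if does d then y ē (e , true) else ∑λ S (part (rs ē)) (λ m → pathFlow m ē (e , true)))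
               + (if does d then y ē (e , false) else ∑λ S (part (rs ē)) (λ m → pathFlow m ē (e , false))))
      by-cut ē (yes _) = trans (+-identityˡ _) (*-identityˡ _)
      by-cut ē (no _)  = trans (cong (internal +_) (*-zeroˡ (D ē * (y ē (e , true) + y ē (e , false)))))
                               (trans (+-identityʳ internal) (∑λ-*-distrib-+ (part (rs ē)) (D ē) (λ m → pathFlow m ē (e , true)) (λ m → pathFlow m ē (e , false))))
        where
        internal : ℚ
        internal = ∑λ S (part (rs ē)) (λ m → D ē * (pathFlow m ē (e , true) + pathFlow m ē (e , false)))

    mappingCosts-by-edge : ∑ k (λ i → ∑λ S i (λ m → ℕ→ℚ (mcost m)))
      ≡ ∑ nr (λ x → ∑λ S (part x) (λ m → nodeCost m x))
        + ∑ er (λ ē → if does (cut? ē) then 0ℚ else ∑λ S (part (rs ē)) (λ m → pathCost m ē))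
    mappingCosts-by-edge = begin
      ∑ k (λ i → ∑λ S i (λ m → ℕ→ℚ (mcost m)))
        ≡⟨ ∑-cong k (λ i → trans (∑λ-cong i (λ m → ℕ→ℚ (mcost m)) (λ m → nodeTerms m + edgeTerms m) (λ m → ℕ→ℚ-mcost (proj₁ m)))
                                 (∑λ-distrib-+ i nodeTerms edgeTerms)) ⟩
      ∑ k (λ i → ∑λ S i nodeTerms + ∑λ S i edgeTerms)
        ≡⟨ ∑-distrib-+ k _ _ ⟩
      ∑ k (λ i → ∑λ S i nodeTerms) + ∑ k (λ i → ∑λ S i edgeTerms)
        ≡⟨ cong₂ _+_ (∑-parts-nodes nodeCost) (∑-parts-edges pathCost) ⟩
      ∑ nr (λ x → ∑λ S (part x) (λ m → nodeCost m x))
        + ∑ er (λ ē → if does (cut? ē) then 0ℚ else ∑λ S (part (rs ē)) (λ m → pathCost m ē))  ∎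
      where
      open ≡-Reasoning
      nodeTerms edgeTerms : Column
      nodeTerms {j} m = ∑ nr (λ x → [ part x ≟F j ] * nodeCost m x)
      edgeTerms {j} m = ∑ er (λ ē → [ edgeIn? j ē ] * pathCost m ē)

    objective-by-edge : objective S ≡ ∑ nr (λ x → ∑λ S (part x) (λ m → nodeCost m x))
                                      + ∑ er (λ ē → ∑ es (λ e → arcCost ē e * (arcFlow ē (e , true) + arcFlow ē (e , false))))
    objective-by-edge = begin
      ∑ k (λ i → ∑λ S i (λ m → ℕ→ℚ (mcost m))) + ∑ es (λ e → ∑ er (λ ē → cutCost ē e))
        ≡⟨ cong₂ _+_ mappingCosts-by-edge (∑-comm es er (λ e ē → cutCost ē e)) ⟩
      (Nodes + ∑ er internalCost) + ∑ er (λ ē → ∑ es (cutCost ē))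
        ≡⟨ +-assoc Nodes _ _ ⟩
      Nodes + (∑ er internalCost + ∑ er (λ ē → ∑ es (cutCost ē)))
        ≡⟨ cong (Nodes +_) (sym (∑-distrib-+ er internalCost (λ ē → ∑ es (cutCost ē)))) ⟩
      Nodes + ∑ er (λ ē → internalCost ē + ∑ es (cutCost ē))
        ≡⟨ cong (Nodes +_) (∑-cong er (λ ē → by-cut ē (cut? ē))) ⟩
      Nodes + ∑ er (λ ē → ∑ es (λ e → arcCost ē e * (arcFlow ē (e , true) + arcFlow ē (e , false))))  ∎
      where
      open ≡-Reasoning
      Nodes : ℚ
      Nodes = ∑ nr (λ x → ∑λ S (part x) (λ m → nodeCost m x))
      cutCost : Fin er → Fin es → ℚ
      cutCost ē e = [ cut? ē ] * (arcCost ē e * (y ē (e , true) + y ē (e , false)))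
      internalCost : Fin er → ℚ
      internalCost ē = if does (cut? ē) then 0ℚ else ∑λ S (part (rs ē)) (λ m → pathCost m ē)
      by-cut : ∀ ē (d : Dec (Cut ē)) →
        (if does d then 0ℚ else ∑λ S (part (rs ē)) (λ m → pathCost m ē))
          + ∑ es (λ e → [ d ] * (arcCost ē e * (y ē (e , true) + y ē (e , false))))
        ≡ ∑ es (λ e → arcCost ē e * ((if does d then y ē (e , true) else ∑λ S (part (rs ē)) (λ m → pathFlow m ē (e , true)))
                             + (if does d then y ē (e , false) else ∑λ S (part (rs ē)) (λ m → pathFlow m ē (e , false)))))
      by-cut ē (yes _) = trans (+-identityˡ _) (∑-cong es (λ e → *-identityˡ _))
      by-cut ē (no _)  = begin
        ∑λ S i (λ m → pathCost m ē) + ∑ es (λ e → 0ℚ * (arcCost ē e * (y ē (e , true) + y ē (e , false))))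
          ≡⟨ cong (∑λ S i (λ m → pathCost m ē) +_) (trans (∑-cong es (λ e → *-zeroˡ (arcCost ē e * (y ē (e , true) + y ē (e , false)))))
                                                         (∑-zero es)) ⟩
        ∑λ S i (λ m → pathCost m ē) + 0ℚ
          ≡⟨ +-identityʳ _ ⟩
        ∑λ S i (λ m → pathCost m ē)
          ≡⟨ ∑λ-∑-comm i es (λ m e → arcCost ē e * (pathFlow m ē (e , true) + pathFlow m ē (e , false))) ⟩
        ∑ es (λ e → ∑λ S i (λ m → arcCost ē e * (pathFlow m ē (e , true) + pathFlow m ē (e , false))))
          ≡⟨ ∑-cong es (λ e → ∑λ-*-distrib-+ i (arcCost ē e) (λ m → pathFlow m ē (e , true)) (λ m → pathFlow m ē (e , false))) ⟩
        ∑ es (λ e → arcCost ē e * (∑λ S i (λ m → pathFlow m ē (e , true)) + ∑λ S i (λ m → pathFlow m ē (e , false))))  ∎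
        where
        i : Fin k
        i = part (rs ē)

  module Feasible (S : Solution) (feasible : IsFeasible S) where
    open Solution S

    0≤λ≤1 : ∀ i → All (λ c → 0ℚ ≤ proj₂ c × proj₂ c ≤ 1ℚ) (lam i)
    0≤λ≤1 = proj₁ feasible

    0≤y≤1 : ∀ ē a → Cut ē → 0ℚ ≤ y ē a × y ē a ≤ 1ℚ
    0≤y≤1 = proj₁ (proj₂ feasible)

    covering : ∀ i → 1ℚ ≤ totalWeight S i
    covering = proj₁ (proj₂ (proj₂ feasible))

    conservation : ∀ ē u → Cut ē → Xagg S (rs ē) u - Xagg S (rt ē) u ≡ outflow S ē u - inflow S ē u
    conservation = proj₁ (proj₂ (proj₂ (proj₂ feasible)))

    hostsAtMostOne : ∀ u → ∑ k (λ i → ∑λ S i (λ {j} m → ∑ nr (λ x → [ part x ≟F j ] * ℕ→ℚ (X m x u)))) ≤ 1ℚ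
    hostsAtMostOne = proj₁ (proj₂ (proj₂ (proj₂ (proj₂ feasible))))

    nodeCapacity : ∀ u → ∑ k (λ i → ∑λ S i (λ {j} m → ∑ nr (λ x → [ part x ≟F j ] * ℕ→ℚ (dV x ℕ.* X m x u)))) ≤ ℕ→ℚ (cV u)
    nodeCapacity = proj₁ (proj₂ (proj₂ (proj₂ (proj₂ (proj₂ feasible)))))

    edgeCapacity : ∀ e → ∑ k (λ i → ∑λ S i (λ m → ℕ→ℚ (edgeLoad m e)))
                         + ∑ er (λ ē → [ cut? ē ] * (ℕ→ℚ (dE ē) * (y ē (e , true) + y ē (e , false))))
                       ≤ ℕ→ℚ (cE e)
    edgeCapacity = proj₁ (proj₂ (proj₂ (proj₂ (proj₂ (proj₂ (proj₂ feasible))))))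

    linking : ∀ ē u → Cut ē → Xagg S (rs ē) u ≤ outflow S ē u
    linking = proj₂ (proj₂ (proj₂ (proj₂ (proj₂ (proj₂ (proj₂ feasible))))))

    path : ∀ ē → ¬ Cut ē → (m : FeasMapping (part (rs ē))) →
           IsPath Gs (Mapping.mV (proj₁ m) (rs ē)) (Mapping.mE (proj₁ m) ē) (Mapping.mV (proj₁ m) (rt ē))
    path ē uncut (_ , _ , paths , _) = paths ē (refl , sym (same-part ē uncut))

    0≤arcFlow : ∀ ē a → 0ℚ ≤ arcFlow S ē a
    0≤arcFlow ē a = by-cut (cut? ē)
      where
      by-cut : (d : Dec (Cut ē)) → 0ℚ ≤ (if does d then y ē a else ∑λ S (part (rs ē)) (λ m → pathFlow m ē a))
      by-cut (yes cut) = proj₁ (0≤y≤1 ē a cut)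
      by-cut (no _)    = 0≤∑λ S 0≤λ≤1 (part (rs ē)) (λ m → pathFlow m ē a) (λ m → 0≤ℕ→ℚ (Y (proj₁ m) ē a))

    arcFlow≤totalWeight : ∀ ē a → arcFlow S ē a ≤ totalWeight S (part (rs ē))
    arcFlow≤totalWeight ē a = by-cut (cut? ē)
      where
      by-cut : (d : Dec (Cut ē)) → (if does d then y ē a else ∑λ S (part (rs ē)) (λ m → pathFlow m ē a)) ≤ totalWeight S (part (rs ē))
      by-cut (yes cut)  = ≤-trans (proj₂ (0≤y≤1 ē a cut)) (covering (part (rs ē)))
      by-cut (no uncut) = begin
        ∑λ S i (λ m → pathFlow m ē a)  ≤⟨ ∑λ-mono-≤ S 0≤λ≤1 i (λ m → pathFlow m ē a) (λ _ → 1ℚ) (λ m → path-occurrences≤1 Gs (path ē uncut m) a) ⟩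
        ∑λ S i (λ _ → 1ℚ)                ≡⟨ ∑λ-const S i 1ℚ ⟩
        1ℚ * totalWeight S i             ≡⟨ *-identityˡ _ ⟩
        totalWeight S i                  ∎
        where
        open ≤-Reasoning
        i : Fin k
        i = part (rs ē)

    arcFlow-conservation : ∀ ē u → Xagg S (rs ē) u - Xagg S (rt ē) u ≡ outflowOf Gs (arcFlow S ē) u - inflowOf Gs (arcFlow S ē) u
    arcFlow-conservation ē u = by-cut (cut? ē)
      where
      flow : Dec (Cut ē) → Arc Gs → ℚ
      flow d a = if does d then y ē a else ∑λ S (part (rs ē)) (λ m → pathFlow m ē a)
      by-cut : (d : Dec (Cut ē)) → Xagg S (rs ē) u - Xagg S (rt ē) u ≡ outflowOf Gs (flow d) u - inflowOf Gs (flow d) u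
      by-cut (yes cut)  = conservation ē u cut
      by-cut (no uncut) = begin
        Xagg S (rs ē) u - Xagg S (rt ē) u
          ≡⟨ cong (λ j → Xagg S (rs ē) u - ∑λ S j (λ m → ℕ→ℚ (X m (rt ē) u))) (sym (same-part ē uncut)) ⟩
        ∑λ S i (λ m → ℕ→ℚ (X m (rs ē) u)) - ∑λ S i (λ m → ℕ→ℚ (X m (rt ē) u))
          ≡⟨ ∑λ-distrib-- S i (λ m → ℕ→ℚ (X m (rs ē) u)) (λ m → ℕ→ℚ (X m (rt ē) u)) ⟨
        ∑λ S i (λ m → ℕ→ℚ (X m (rs ē) u) - ℕ→ℚ (X m (rt ē) u))
          ≡⟨ ∑λ-cong S i (λ m → ℕ→ℚ (X m (rs ē) u) - ℕ→ℚ (X m (rt ē) u))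
                         (λ m → outflowOf Gs (pathFlow m ē) u - inflowOf Gs (pathFlow m ē) u) (λ m → trans (cong₂ _-_ ([]ℕ→ℚ (Mapping.mV (proj₁ m) (rs ē) ≟F u)) ([]ℕ→ℚ (Mapping.mV (proj₁ m) (rt ē) ≟F u))) (sym (walk-balance Gs (proj₁ (path ē uncut m)) u))) ⟩
        ∑λ S i (λ m → outflowOf Gs (pathFlow m ē) u - inflowOf Gs (pathFlow m ē) u)
          ≡⟨ ∑λ-distrib-- S i (λ m → outflowOf Gs (pathFlow m ē) u) (λ m → inflowOf Gs (pathFlow m ē) u) ⟩
        ∑λ S i (λ m → outflowOf Gs (pathFlow m ē) u) - ∑λ S i (λ m → inflowOf Gs (pathFlow m ē) u)
          ≡⟨ cong₂ _-_ (flowAt-∑λ S i (tail Gs) (λ m → pathFlow m ē) u) (flowAt-∑λ S i (head Gs) (λ m → pathFlow m ē) u) ⟨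
        outflowOf Gs (flow (no uncut)) u - inflowOf Gs (flow (no uncut)) u  ∎
        where
        open ≡-Reasoning
        i : Fin k
        i = part (rs ē)

    arcFlow-linking : (∀ ē → rs ē ≢ rt ē) → ∀ ē u → Xagg S (rs ē) u ≤ outflowOf Gs (arcFlow S ē) u
    arcFlow-linking loopless ē u = by-cut (cut? ē)
      where
      flow : Dec (Cut ē) → Arc Gs → ℚ
      flow d a = if does d then y ē a else ∑λ S (part (rs ē)) (λ m → pathFlow m ē a)
      by-cut : (d : Dec (Cut ē)) → Xagg S (rs ē) u ≤ outflowOf Gs (flow d) u
      by-cut (yes cut)  = linking ē u cut
      by-cut (no uncut) = begin
        ∑λ S i (λ m → ℕ→ℚ (X m (rs ē) u))
          ≤⟨ ∑λ-mono-≤ S 0≤λ≤1 i (λ m → ℕ→ℚ (X m (rs ē) u)) (λ m → outflowOf Gs (pathFlow m ē) u) leaves ⟩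
        ∑λ S i (λ m → outflowOf Gs (pathFlow m ē) u)
          ≡⟨ flowAt-∑λ S i (tail Gs) (λ m → pathFlow m ē) u ⟨
        outflowOf Gs (flow (no uncut)) u  ∎
        where
        open ≤-Reasoning
        i : Fin k
        i = part (rs ē)
        leaves : (m : FeasMapping i) → ℕ→ℚ (X (proj₁ m) (rs ē) u) ≤ outflowOf Gs (pathFlow (proj₁ m) ē) u
        leaves m@(_ , injective , _) = subst (_≤ outflowOf Gs (pathFlow (proj₁ m) ē) u) (sym ([]ℕ→ℚ (Mapping.mV (proj₁ m) (rs ē) ≟F u)))
          (walk-outflow≥ Gs (proj₁ (path ē uncut m))
             (λ same → loopless ē (injective (rs ē) (rt ē) refl (sym (same-part ē uncut)) same)) u)

    ∑-Xagg : ∀ x → ∑ ns (Xagg S x) ≡ totalWeight S (part x)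
    ∑-Xagg x = begin
      ∑ ns (λ u → ∑λ S (part x) (λ m → ℕ→ℚ (X m x u)))  ≡⟨ ∑λ-∑-comm S (part x) ns (λ m u → ℕ→ℚ (X m x u)) ⟨
      ∑λ S (part x) (λ m → ∑ ns (λ u → ℕ→ℚ (X m x u)))  ≡⟨ ∑λ-cong S (part x) (λ m → ∑ ns (λ u → ℕ→ℚ (X m x u))) (λ _ → 1ℚ) (λ m → placed-once (proj₁ m)) ⟩
      ∑λ S (part x) (λ _ → 1ℚ)                          ≡⟨ ∑λ-const S (part x) 1ℚ ⟩
      1ℚ * totalWeight S (part x)                       ≡⟨ *-identityˡ _ ⟩
      totalWeight S (part x)                            ∎
      where
      open ≡-Reasoning
      placed-once : ∀ {j} (m : Mapping j) → ∑ ns (λ u → ℕ→ℚ (X m x u)) ≡ 1ℚ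
      placed-once m = trans (∑-cong ns (λ u → trans ([]ℕ→ℚ (Mapping.mV m x ≟F u)) (sym (*-identityʳ [ Mapping.mV m x ≟F u ]))))
                            (∑-[≟] ns (Mapping.mV m x) (λ _ → 1ℚ))

    totalWeight-edge : ∀ ē → totalWeight S (part (rs ē)) ≡ totalWeight S (part (rt ē))
    totalWeight-edge ē = x∙y⁻¹≈ε⇒x≈y _ _ (begin
      totalWeight S (part (rs ē)) - totalWeight S (part (rt ē))
        ≡⟨ cong₂ _-_ (∑-Xagg (rs ē)) (∑-Xagg (rt ē)) ⟨
      ∑ ns (Xagg S (rs ē)) - ∑ ns (Xagg S (rt ē))
        ≡⟨ ∑-distrib-- ns (Xagg S (rs ē)) (Xagg S (rt ē)) ⟨
      ∑ ns (λ u → Xagg S (rs ē) u - Xagg S (rt ē) u)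
        ≡⟨ ∑-cong ns (arcFlow-conservation ē) ⟩
      ∑ ns (λ u → outflowOf Gs (arcFlow S ē) u - inflowOf Gs (arcFlow S ē) u)
        ≡⟨ ∑-distrib-- ns _ _ ⟩
      ∑ ns (outflowOf Gs (arcFlow S ē)) - ∑ ns (inflowOf Gs (arcFlow S ē))
        ≡⟨ cong₂ _-_ (∑-flowAt Gs (tail Gs) (arcFlow S ē)) (∑-flowAt Gs (head Gs) (arcFlow S ē)) ⟩
      Total - Total
        ≡⟨ +-inverseʳ Total ⟩
      0ℚ  ∎)
      where
      open ≡-Reasoning
      Total : ℚ
      Total = ∑ es (λ e → arcFlow S ē (e , true) + arcFlow S ē (e , false))

    mappingCosts≤objective : ∑ k (λ i → ∑λ S i (λ m → ℕ→ℚ (mcost m))) ≤ objective S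
    mappingCosts≤objective = begin
      Mappings       ≡⟨ +-identityʳ Mappings ⟨
      Mappings + 0ℚ  ≤⟨ +-monoʳ-≤ Mappings (0≤∑ es {cutCosts} (λ e → 0≤∑ er (λ ē → by-cut e ē (cut? ē)))) ⟩
      objective S    ∎
      where
      open ≤-Reasoning
      Mappings : ℚ
      Mappings = ∑ k (λ i → ∑λ S i (λ m → ℕ→ℚ (mcost m)))
      cutCosts : Fin es → ℚ
      cutCosts e = ∑ er (λ ē → [ cut? ē ] * (arcCost ē e * (y ē (e , true) + y ē (e , false))))
      by-cut : ∀ e ē (d : Dec (Cut ē)) → 0ℚ ≤ [ d ] * (arcCost ē e * (y ē (e , true) + y ē (e , false)))
      by-cut e ē (yes cut) = 0≤* (0≤[] (yes cut)) (0≤* (0≤ℕ→ℚ (wE e ℕ.* dE ē))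
                                  (+-mono-≤ {0ℚ} {_} {0ℚ} (proj₁ (0≤y≤1 ē (e , true) cut)) (proj₁ (0≤y≤1 ē (e , false) cut))))
      by-cut e ē (no uncut) = ≤-reflexive (sym (*-zeroˡ (arcCost ē e * (y ē (e , true) + y ē (e , false)))))

    0≤objective : 0ℚ ≤ objective S
    0≤objective = ≤-trans (0≤∑ k (λ i → 0≤∑λ S 0≤λ≤1 i (λ m → ℕ→ℚ (mcost m)) (λ m → 0≤ℕ→ℚ (mcost (proj₁ m)))))
                          mappingCosts≤objective

1/-cong : ∀ p q .{{_ : NonZero p}} .{{_ : NonZero q}} → p ≡ q → 1/ p ≡ 1/ q
1/-cong p .p refl = refl

module Refinement (I : Instance) (π π′ : Partition (Graph.n (Instance.Gr I))) (π′⊑π : Refines π′ π) where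
  open Instance I
  open Partition π using (k; part)
  open Partition π′ using () renaming (k to k′; part to part′; nonempty to nonempty′)
  module C = VPF I π
  module F = VPF I π′
  module CC = Columns I π
  module FC = Columns I π′
  open C using (nr; er; ns; es; rs; rt)

  parent : Fin k′ → Fin k
  parent i′ = part (proj₁ (nonempty′ i′))

  parent-part′ : ∀ x → parent (part′ x) ≡ part x
  parent-part′ x = π′⊑π (proj₁ (nonempty′ (part′ x))) x (proj₂ (nonempty′ (part′ x)))

  in-parent : ∀ {i′ x} → part′ x ≡ i′ → part x ≡ parent i′
  in-parent {x = x} x∈i′ = trans (sym (parent-part′ x)) (cong parent x∈i′)

  uncut-refined : ∀ ē → ¬ F.Cut ē → ¬ C.Cut ē
  uncut-refined ē uncut′ cut = cut (π′⊑π (rs ē) (rt ē) (decidable-stable (part′ (rs ē) ≟F part′ (rt ē)) uncut′))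

  restrict : ∀ {i′} → C.Mapping (parent i′) → F.Mapping i′
  restrict m = record { mV = C.Mapping.mV m ; mE = C.Mapping.mE m }

  restrict-feasible : ∀ {i′} (m : C.Mapping (parent i′)) → C.IsFeasibleMapping m → F.IsFeasibleMapping (restrict {i′} m)
  restrict-feasible {i′} m (injective , paths , nodeCap , edgeCap) =
      (λ x x′ x∈i′ x′∈i′ → injective x x′ (in-parent x∈i′) (in-parent x′∈i′))
    , (λ ē (s∈i′ , t∈i′) → paths ē (in-parent s∈i′ , in-parent t∈i′))
    , (λ u → ℕ.≤-trans (∑ℕ-mono-≤ nr (λ x → ℕ.*-monoˡ-≤ (dV x ℕ.* C.X m x u)
                                        ([]ℕ-mono (part′ x ≟F i′) (part x ≟F parent i′) in-parent)))
                       (nodeCap u))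
    , (λ e → ℕ.≤-trans (∑ℕ-mono-≤ er (λ ē → ℕ.*-monoˡ-≤ (dE ē ℕ.* (C.Y m ē (e , false) ℕ.+ C.Y m ē (e , true)))
                                        ([]ℕ-mono (F.edgeIn? i′ ē) (C.edgeIn? (parent i′) ē)
                                                  (λ (s∈i′ , t∈i′) → in-parent s∈i′ , in-parent t∈i′))))
                       (edgeCap e))

  module _ (S : C.Solution) (feasible : C.IsFeasible S) where
    open C.Solution S
    open CC.Feasible S feasible
    open CC using (totalWeight; arcFlow)

    weight-positive : ∀ i → Positive (totalWeight S i)
    weight-positive i = positive (<-≤-trans (*<* (ℤ.+<+ (ℕ.s≤s ℕ.z≤n))) (covering i))

    private instance
      weight≢0 : ∀ {i} → NonZero (totalWeight S i)
      weight≢0 {i} = pos⇒nonZero (totalWeight S i) {{weight-positive i}}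

    scale : Fin k → ℚ
    scale i = 1/ totalWeight S i

    scale-inverse : ∀ i → scale i * totalWeight S i ≡ 1ℚ
    scale-inverse i = *-inverseˡ (totalWeight S i)

    0≤scale : ∀ i → 0ℚ ≤ scale i
    0≤scale i = <⇒≤ (positive⁻¹ (scale i) {{1/pos⇒pos (totalWeight S i) {{weight-positive i}}}})

    scale≤1 : ∀ i → scale i ≤ 1ℚ
    scale≤1 i = begin
      scale i                    ≡⟨ *-identityʳ (scale i) ⟨
      scale i * 1ℚ               ≤⟨ *-monoˡ-≤-≥0 (0≤scale i) (covering i) ⟩
      scale i * totalWeight S i  ≡⟨ scale-inverse i ⟩
      1ℚ                         ∎
      where open ≤-Reasoning

    scale-shrinks : ∀ i {p} → 0ℚ ≤ p → scale i * p ≤ p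
    scale-shrinks i = ≤1⇒*≤ (0≤scale i) (scale≤1 i)

    scale-edge : ∀ ē → scale (part (rs ē)) ≡ scale (part (rt ē))
    scale-edge ē = 1/-cong _ _ (totalWeight-edge ē)

    refined : F.Solution
    refined = record
      { lam = λ i′ → map (λ c → ((restrict (proj₁ (proj₁ c)) , restrict-feasible (proj₁ (proj₁ c)) (proj₂ (proj₁ c)))
                                , proj₂ c * scale (parent i′)))
                         (lam (parent i′))
      ; y   = λ ē a → scale (part (rs ē)) * arcFlow S ē a
      }

    ∑λ-refined : ∀ i′ (h : (Fin nr → Fin ns) → (Fin er → List (Arc Gs)) → ℚ) →
      F.∑λ refined i′ (λ m → h (F.Mapping.mV m) (F.Mapping.mE m))
        ≡ scale (parent i′) * C.∑λ S (parent i′) (λ m → h (C.Mapping.mV m) (C.Mapping.mE m))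
    ∑λ-refined i′ h = begin
      F.∑λ refined i′ (λ m → h (F.Mapping.mV m) (F.Mapping.mE m))
        ≡⟨ ∑L-map _ (lam (parent i′)) (λ c → h (F.Mapping.mV (proj₁ (proj₁ c))) (F.Mapping.mE (proj₁ (proj₁ c))) * proj₂ c) ⟩
      ∑L (lam (parent i′)) (λ c → value c * (proj₂ c * s))
        ≡⟨ ∑L-cong (lam (parent i′)) (λ c → rearrange (value c) (proj₂ c) s) ⟩
      ∑L (lam (parent i′)) (λ c → s * (value c * proj₂ c))
        ≡⟨ *-distribˡ-∑L (lam (parent i′)) s (λ c → value c * proj₂ c) ⟨
      s * C.∑λ S (parent i′) (λ m → h (C.Mapping.mV m) (C.Mapping.mE m))  ∎
      where
      open ≡-Reasoning
      open +-*-Solver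
      s : ℚ
      s = scale (parent i′)
      value : C.FeasMapping (parent i′) × ℚ → ℚ
      value c = h (C.Mapping.mV (proj₁ (proj₁ c))) (C.Mapping.mE (proj₁ (proj₁ c)))
      rearrange : ∀ a b c → a * (b * c) ≡ c * (a * b)
      rearrange = solve 3 (λ a b c → a :* (b :* c) := c :* (a :* b)) refl

    ∑λ-refined-at : ∀ x (h : (Fin nr → Fin ns) → (Fin er → List (Arc Gs)) → ℚ) →
      F.∑λ refined (part′ x) (λ m → h (F.Mapping.mV m) (F.Mapping.mE m))
        ≡ scale (part x) * C.∑λ S (part x) (λ m → h (C.Mapping.mV m) (C.Mapping.mE m))
    ∑λ-refined-at x h = trans (∑λ-refined (part′ x) h)
      (cong (λ i → scale i * C.∑λ S i (λ m → h (C.Mapping.mV m) (C.Mapping.mE m))) (parent-part′ x))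

    Xagg-refined : ∀ x u → F.Xagg refined x u ≡ scale (part x) * C.Xagg S x u
    Xagg-refined x u = ∑λ-refined-at x (λ mV _ → ℕ→ℚ [ mV x ≟F u ]ℕ)

    arcFlow-refined : ∀ ē a → FC.arcFlow refined ē a ≡ scale (part (rs ē)) * arcFlow S ē a
    arcFlow-refined ē a = by-cut (F.cut? ē)
      where
      by-cut : (d′ : Dec (F.Cut ē)) →
        (if does d′ then scale (part (rs ē)) * arcFlow S ē a else F.∑λ refined (part′ (rs ē)) (λ m → FC.pathFlow m ē a))
          ≡ scale (part (rs ē)) * arcFlow S ē a
      by-cut (yes _)     = refl
      by-cut (no uncut′) = trans (∑λ-refined-at (rs ē) (λ _ mE → occurrences Gs (mE ē) a))
                                 (cong (scale (part (rs ē)) *_) (coarse (C.cut? ē)))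
        where
        coarse : (d : Dec (C.Cut ē)) →
          C.∑λ S (part (rs ē)) (λ m → CC.pathFlow m ē a) ≡ (if does d then y ē a else C.∑λ S (part (rs ē)) (λ m → CC.pathFlow m ē a))
        coarse (yes cut) = ⊥-elim (uncut-refined ē uncut′ cut)
        coarse (no _)    = refl

    arcPair-refined≤ : ∀ c ē e → 0ℚ ≤ c →
      c * (FC.arcFlow refined ē (e , true) + FC.arcFlow refined ē (e , false)) ≤ c * (arcFlow S ē (e , true) + arcFlow S ē (e , false))
    arcPair-refined≤ c ē e 0≤c = begin
      c * (FC.arcFlow refined ē (e , true) + FC.arcFlow refined ē (e , false))
        ≡⟨ cong (c *_) (cong₂ _+_ (arcFlow-refined ē (e , true)) (arcFlow-refined ē (e , false))) ⟩
      c * (s * arcFlow S ē (e , true) + s * arcFlow S ē (e , false))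
        ≡⟨ factor c s (arcFlow S ē (e , true)) (arcFlow S ē (e , false)) ⟩
      s * (c * (arcFlow S ē (e , true) + arcFlow S ē (e , false)))
        ≤⟨ scale-shrinks (part (rs ē)) (0≤* 0≤c (+-mono-≤ {0ℚ} {_} {0ℚ} (0≤arcFlow ē (e , true)) (0≤arcFlow ē (e , false)))) ⟩
      c * (arcFlow S ē (e , true) + arcFlow S ē (e , false))  ∎
      where
      open ≤-Reasoning
      open +-*-Solver
      s : ℚ
      s = scale (part (rs ē))
      factor : ∀ c s a b → c * (s * a + s * b) ≡ s * (c * (a + b))
      factor = solve 4 (λ c s a b → c :* (s :* a :+ s :* b) := s :* (c :* (a :+ b))) refl

    nodeTotals-refined≤ : (h : (Fin nr → Fin ns) → Fin nr → ℚ) → (∀ mV x → 0ℚ ≤ h mV x) →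
      ∑ k′ (λ i → F.∑λ refined i (λ {j} m → ∑ nr (λ x → [ part′ x ≟F j ] * h (F.Mapping.mV m) x)))
        ≤ ∑ k (λ i → C.∑λ S i (λ {j} m → ∑ nr (λ x → [ part x ≟F j ] * h (C.Mapping.mV m) x)))
    nodeTotals-refined≤ h 0≤h = begin
      ∑ k′ (λ i → F.∑λ refined i (λ {j} m → ∑ nr (λ x → [ part′ x ≟F j ] * h (F.Mapping.mV m) x)))
        ≡⟨ FC.∑-parts-nodes refined (λ m x → h (F.Mapping.mV m) x) ⟩
      ∑ nr (λ x → F.∑λ refined (part′ x) (λ m → h (F.Mapping.mV m) x))
        ≤⟨ ∑-mono-≤ nr at ⟩
      ∑ nr (λ x → C.∑λ S (part x) (λ m → h (C.Mapping.mV m) x))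
        ≡⟨ CC.∑-parts-nodes S (λ m x → h (C.Mapping.mV m) x) ⟨
      ∑ k (λ i → C.∑λ S i (λ {j} m → ∑ nr (λ x → [ part x ≟F j ] * h (C.Mapping.mV m) x)))  ∎
      where
      open ≤-Reasoning
      at : ∀ x → F.∑λ refined (part′ x) (λ m → h (F.Mapping.mV m) x) ≤ C.∑λ S (part x) (λ m → h (C.Mapping.mV m) x)
      at x = ≤-trans (≤-reflexive (∑λ-refined-at x (λ mV _ → h mV x)))
                     (scale-shrinks (part x) (CC.0≤∑λ S 0≤λ≤1 (part x) (λ m → h (C.Mapping.mV m) x) (λ m → 0≤h _ x)))

    edgeLoads-refined≤ : ∀ e →
      ∑ k′ (λ i → F.∑λ refined i (λ mp → ℕ→ℚ (F.edgeLoad mp e)))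
        + ∑ er (λ ē → [ F.cut? ē ] * (ℕ→ℚ (dE ē) * (F.Solution.y refined ē (e , true) + F.Solution.y refined ē (e , false))))
      ≤ ∑ k (λ i → C.∑λ S i (λ mp → ℕ→ℚ (C.edgeLoad mp e)))
        + ∑ er (λ ē → [ C.cut? ē ] * (ℕ→ℚ (dE ē) * (y ē (e , true) + y ē (e , false))))
    edgeLoads-refined≤ e = ≤-trans (≤-reflexive (FC.edgeLoad-by-edge refined e))
      (≤-trans (∑-mono-≤ er (λ ē → arcPair-refined≤ (ℕ→ℚ (dE ē)) ē e (0≤ℕ→ℚ (dE ē))))
               (≤-reflexive (sym (CC.edgeLoad-by-edge S e))))

    objective-refined≤ : F.objective refined ≤ C.objective S
    objective-refined≤ = ≤-trans (≤-reflexive (FC.objective-by-edge refined))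
      (≤-trans (+-mono-≤ (∑-mono-≤ nr nodes) (∑-mono-≤ er (λ ē → ∑-mono-≤ es (λ e → arcPair-refined≤ (CC.arcCost ē e) ē e (0≤ℕ→ℚ (wE e ℕ.* dE ē))))))
               (≤-reflexive (sym (CC.objective-by-edge S))))
      where
      nodes : ∀ x → F.∑λ refined (part′ x) (λ m → FC.nodeCost m x) ≤ C.∑λ S (part x) (λ m → CC.nodeCost m x)
      nodes x = ≤-trans (≤-reflexive (∑λ-refined-at x (λ mV _ → ℕ→ℚ (dV x ℕ.* wV (mV x)))))
                        (scale-shrinks (part x) (CC.0≤∑λ S 0≤λ≤1 (part x) (λ m → CC.nodeCost m x)
                                                   (λ m → 0≤ℕ→ℚ (dV x ℕ.* wV (C.Mapping.mV (proj₁ m) x)))))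

    refined-feasible : (∀ ē → rs ē ≢ rt ē) → F.IsFeasible refined
    refined-feasible loopless = 0≤λ′≤1 , 0≤y′≤1 , covering′ , conservation′
      , (λ u → ≤-trans (nodeTotals-refined≤ (λ mV x → ℕ→ℚ [ mV x ≟F u ]ℕ) (λ mV x → 0≤ℕ→ℚ [ mV x ≟F u ]ℕ))
                       (hostsAtMostOne u))
      , (λ u → ≤-trans (nodeTotals-refined≤ (λ mV x → ℕ→ℚ (dV x ℕ.* [ mV x ≟F u ]ℕ)) (λ mV x → 0≤ℕ→ℚ (dV x ℕ.* [ mV x ≟F u ]ℕ)))
                       (nodeCapacity u))
      , (λ e → ≤-trans (edgeLoads-refined≤ e) (edgeCapacity e))
      , linking′
      where
      0≤λ′≤1 : ∀ i′ → All (λ c → 0ℚ ≤ proj₂ c × proj₂ c ≤ 1ℚ) (F.Solution.lam refined i′)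
      0≤λ′≤1 i′ = All.map⁺ (All.map (λ {c} (0≤w , w≤1) → 0≤* 0≤w (0≤scale (parent i′))
                                    , ≤-trans (≤-reflexive (*-comm (proj₂ c) _)) (≤-trans (scale-shrinks (parent i′) 0≤w) w≤1))
                                    (0≤λ≤1 (parent i′)))
      0≤y′≤1 : ∀ ē a → F.Cut ē → 0ℚ ≤ scale (part (rs ē)) * arcFlow S ē a × scale (part (rs ē)) * arcFlow S ē a ≤ 1ℚ
      0≤y′≤1 ē a _ = 0≤* (0≤scale (part (rs ē))) (0≤arcFlow ē a)
                   , ≤-trans (*-monoˡ-≤-≥0 (0≤scale (part (rs ē))) (arcFlow≤totalWeight ē a)) (≤-reflexive (scale-inverse (part (rs ē))))
      covering′ : ∀ i′ → 1ℚ ≤ FC.totalWeight refined i′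
      covering′ i′ = ≤-reflexive (begin
        1ℚ                                       ≡⟨ scale-inverse (parent i′) ⟨
        scale (parent i′) * totalWeight S (parent i′)
          ≡⟨ cong (scale (parent i′) *_) (trans (sym (*-identityˡ _)) (sym (CC.∑λ-const S (parent i′) 1ℚ))) ⟩
        scale (parent i′) * C.∑λ S (parent i′) (λ _ → 1ℚ)
          ≡⟨ ∑λ-refined i′ (λ _ _ → 1ℚ) ⟨
        F.∑λ refined i′ (λ _ → 1ℚ)
          ≡⟨ trans (FC.∑λ-const refined i′ 1ℚ) (*-identityˡ _) ⟩
        FC.totalWeight refined i′  ∎)
        where open ≡-Reasoning
      conservation′ : ∀ ē u → F.Cut ē → F.Xagg refined (rs ē) u - F.Xagg refined (rt ē) u ≡ F.outflow refined ē u - F.inflow refined ē u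
      conservation′ ē u _ = begin
        F.Xagg refined (rs ē) u - F.Xagg refined (rt ē) u
          ≡⟨ cong₂ _-_ (Xagg-refined (rs ē) u) (trans (Xagg-refined (rt ē) u) (cong (_* C.Xagg S (rt ē) u) (sym (scale-edge ē)))) ⟩
        s * C.Xagg S (rs ē) u - s * C.Xagg S (rt ē) u
          ≡⟨ x[y-z]≈xy-xz s (C.Xagg S (rs ē) u) (C.Xagg S (rt ē) u) ⟨
        s * (C.Xagg S (rs ē) u - C.Xagg S (rt ē) u)
          ≡⟨ cong (s *_) (arcFlow-conservation ē u) ⟩
        s * (outflowOf Gs (arcFlow S ē) u - inflowOf Gs (arcFlow S ē) u)
          ≡⟨ x[y-z]≈xy-xz s (outflowOf Gs (arcFlow S ē) u) (inflowOf Gs (arcFlow S ē) u) ⟩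
        s * outflowOf Gs (arcFlow S ē) u - s * inflowOf Gs (arcFlow S ē) u
          ≡⟨ cong₂ _-_ (flowAt-*ˡ Gs (tail Gs) s (arcFlow S ē) u) (flowAt-*ˡ Gs (head Gs) s (arcFlow S ē) u) ⟨
        F.outflow refined ē u - F.inflow refined ē u  ∎
        where
        open ≡-Reasoning
        s : ℚ
        s = scale (part (rs ē))
      linking′ : ∀ ē u → F.Cut ē → F.Xagg refined (rs ē) u ≤ F.outflow refined ē u
      linking′ ē u _ = begin
        F.Xagg refined (rs ē) u              ≡⟨ Xagg-refined (rs ē) u ⟩
        s * C.Xagg S (rs ē) u                ≤⟨ *-monoˡ-≤-≥0 (0≤scale (part (rs ē))) (arcFlow-linking loopless ē u) ⟩
        s * outflowOf Gs (arcFlow S ē) u     ≡⟨ flowAt-*ˡ Gs (tail Gs) s (arcFlow S ē) u ⟨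
        F.outflow refined ē u                ∎
        where
        open ≤-Reasoning
        s : ℚ
        s = scale (part (rs ē))

refinement-monotone : ∀ (I : Instance) → (∀ ē → Graph.src (Instance.Gr I) ē ≢ Graph.tgt (Instance.Gr I) ē) →
  (π π′ : Partition (Graph.n (Instance.Gr I))) → Refines π′ π →
  ∀ v v′ → VPF.IsOptimalValue I π v → VPF.IsOptimalValue I π′ v′ → v′ ≤ v
refinement-monotone I loopless π π′ π′⊑π v v′ ((S , feasible , S≡v) , _) (_ , v′-minimal) = begin
  v′                                       ≤⟨ v′-minimal (refined S feasible) (refined-feasible S feasible loopless) ⟩
  VPF.objective I π′ (refined S feasible)  ≤⟨ objective-refined≤ S feasible ⟩
  VPF.objective I π S                      ≡⟨ S≡v ⟩
  v                                        ∎
  where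
  open Refinement I π π′ π′⊑π
  open ≤-Reasoning

-- One virtual edge, to be embedded in the path 0 — 1 — 2 — 3 where only
-- the substrate nodes 1 and 2 have capacity and the middle edge costs B.
module GapExample (B : ℕ) where

  K₂ : Graph
  K₂ = record { n = 2 ; m = 1 ; src = λ _ → 0F ; tgt = λ _ → 1F }

  P₄ : Graph
  P₄ = record { n = 4 ; m = 3 ; src = inject₁ ; tgt = suc }

  nodeCapacity : Fin 4 → ℕ
  nodeCapacity 0F = 0
  nodeCapacity 1F = 1
  nodeCapacity 2F = 1
  nodeCapacity 3F = 0

  edgeCost : Fin 3 → ℕ
  edgeCost 0F = 0
  edgeCost 1F = B
  edgeCost 2F = 0

  gapInstance : Instance
  gapInstance = record { Gr = K₂ ; Gs = P₄ ; dV = λ _ → 1 ; dE = λ _ → 1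
                       ; cV = nodeCapacity ; cE = λ _ → 1 ; wV = λ _ → 0 ; wE = edgeCost }

  gapInstance-valid : ValidInstance gapInstance
  gapInstance-valid = ((λ { 0F () }) , (λ { 0F 0F _ → refl }))
                    , K₂-connected
                    , ((λ { 0F () ; 1F () ; 2F () }) , P₄-no-parallel)
                    , (λ u v → proj₁ (to-0 u) ++ proj₁ (from-0 v) , IsWalk-++ P₄ (proj₂ (to-0 u)) (proj₂ (from-0 v)))
    where
    K₂-connected : Connected K₂
    K₂-connected 0F 0F = [] , nil
    K₂-connected 0F 1F = (0F , true) ∷ [] , cons refl nil
    K₂-connected 1F 0F = (0F , false) ∷ [] , cons refl nil
    K₂-connected 1F 1F = [] , nil
    P₄-no-parallel : ∀ e e′ → ((inject₁ e ≡ inject₁ e′ × suc e ≡ suc e′) ⊎ (inject₁ e ≡ suc e′ × suc e ≡ inject₁ e′)) → e ≡ e′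
    P₄-no-parallel e e′ (inj₁ (_ , same)) = Fin.suc-injective same
    P₄-no-parallel 0F 0F (inj₂ _) = refl
    P₄-no-parallel 1F 1F (inj₂ _) = refl
    P₄-no-parallel 2F 2F (inj₂ _) = refl
    P₄-no-parallel 0F 1F (inj₂ (() , _))
    P₄-no-parallel 0F 2F (inj₂ (() , _))
    P₄-no-parallel 1F 0F (inj₂ (_ , ()))
    P₄-no-parallel 1F 2F (inj₂ (() , _))
    P₄-no-parallel 2F 0F (inj₂ (_ , ()))
    P₄-no-parallel 2F 1F (inj₂ (_ , ()))
    to-0 : ∀ u → ∃ λ as → IsWalk P₄ u as 0F
    to-0 0F = [] , nil
    to-0 1F = (0F , false) ∷ [] , cons refl nil
    to-0 2F = (1F , false) ∷ (0F , false) ∷ [] , cons refl (cons refl nil)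
    to-0 3F = (2F , false) ∷ (1F , false) ∷ (0F , false) ∷ [] , cons refl (cons refl (cons refl nil))
    from-0 : ∀ u → ∃ λ as → IsWalk P₄ 0F as u
    from-0 0F = [] , nil
    from-0 1F = (0F , true) ∷ [] , cons refl nil
    from-0 2F = (0F , true) ∷ (1F , true) ∷ [] , cons refl (cons refl nil)
    from-0 3F = (0F , true) ∷ (1F , true) ∷ (2F , true) ∷ [] , cons refl (cons refl (cons refl nil))

  whole singletons : Partition 2
  whole      = record { k = 1 ; part = λ _ → 0F ; nonempty = λ { 0F → 0F , refl } }
  singletons = record { k = 2 ; part = λ x → x ; nonempty = λ i → i , refl }

  singletons⊑whole : Refines singletons whole
  singletons⊑whole _ _ _ = refl

  module C = VPF gapInstance whole
  module F = VPF gapInstance singletons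

  placeAt : ∀ {i} → Fin 4 → F.Mapping i
  placeAt u = record { mV = λ _ → u ; mE = λ _ → [] }

  placeAt-feasible : ∀ i u → nodeCapacity u ≡ 1 → F.IsFeasibleMapping (placeAt {i} u)
  placeAt-feasible i u cap≡1 = (λ x x′ x∈i x′∈i _ → trans x∈i (sym x′∈i)) , (λ { 0F (refl , ()) }) , nodeLoad i , edgeLoad i
    where
    nodeLoad : ∀ i u′ → F.nodeLoad (placeAt {i} u) u′ ℕ.≤ nodeCapacity u′
    nodeLoad 0F u′ with u ≟F u′
    ... | yes refl rewrite cap≡1 = ℕ.≤-refl
    ... | no _ = ℕ.z≤n
    nodeLoad 1F u′ with u ≟F u′
    ... | yes refl rewrite cap≡1 = ℕ.≤-refl
    ... | no _ = ℕ.z≤n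
    edgeLoad : ∀ i e → F.edgeLoad (placeAt {i} u) e ℕ.≤ 1
    edgeLoad 0F e = ℕ.z≤n
    edgeLoad 1F e = ℕ.z≤n

  -- With the two endpoints in different parts, each may sit half on node 1
  -- and half on node 2, and the linking constraints are met by routing half
  -- a unit back and forth over the free edges 0 — 1 and 2 — 3.
  halves : ∀ i → List (F.FeasMapping i × ℚ)
  halves i = ((placeAt 1F , placeAt-feasible i 1F refl) , ½) ∷ ((placeAt 2F , placeAt-feasible i 2F refl) , ½) ∷ []

  shuttle : Fin 1 → Arc P₄ → ℚ
  shuttle _ (0F , _) = ½
  shuttle _ (1F , _) = 0ℚ
  shuttle _ (2F , _) = ½

  split : F.Solution
  split = record { lam = halves ; y = shuttle }

  split-feasible : F.IsFeasible split
  split-feasible = (λ i → (≤ᵇ⇒≤ tt , ≤ᵇ⇒≤ tt) ∷ (≤ᵇ⇒≤ tt , ≤ᵇ⇒≤ tt) ∷ [])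
                 , (λ { 0F (0F , _) _ → ≤ᵇ⇒≤ tt , ≤ᵇ⇒≤ tt ; 0F (1F , _) _ → ≤ᵇ⇒≤ tt , ≤ᵇ⇒≤ tt ; 0F (2F , _) _ → ≤ᵇ⇒≤ tt , ≤ᵇ⇒≤ tt })
                 , (λ i → ≤ᵇ⇒≤ tt)
                 , (λ { 0F 0F _ → refl ; 0F 1F _ → refl ; 0F 2F _ → refl ; 0F 3F _ → refl })
                 , (λ { 0F → ≤ᵇ⇒≤ tt ; 1F → ≤ᵇ⇒≤ tt ; 2F → ≤ᵇ⇒≤ tt ; 3F → ≤ᵇ⇒≤ tt })
                 , (λ { 0F → ≤ᵇ⇒≤ tt ; 1F → ≤ᵇ⇒≤ tt ; 2F → ≤ᵇ⇒≤ tt ; 3F → ≤ᵇ⇒≤ tt })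
                 , (λ { 0F → ≤ᵇ⇒≤ tt ; 1F → ≤ᵇ⇒≤ tt ; 2F → ≤ᵇ⇒≤ tt })
                 , (λ { 0F 0F _ → ≤ᵇ⇒≤ tt ; 0F 1F _ → ≤ᵇ⇒≤ tt ; 0F 2F _ → ≤ᵇ⇒≤ tt ; 0F 3F _ → ≤ᵇ⇒≤ tt })

  split-objective : F.objective split ≡ 0ℚ
  split-objective = cong (∑ 2 (λ i → F.∑λ split i (λ m → ℕ→ℚ (F.mcost m))) +_) (trans (∑-cong 3 unused) (∑-zero 3))
    where
    unused : ∀ e → ∑ 1 (λ ē → [ F.cut? ē ] * (ℕ→ℚ (edgeCost e ℕ.* 1) * (shuttle ē (e , true) + shuttle ē (e , false)))) ≡ 0ℚ
    unused 0F = refl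
    unused 1F = cong (λ z → 1ℚ * z + 0ℚ) (*-zeroʳ (ℕ→ℚ (B ℕ.* 1)))
    unused 2F = refl

  split-optimal : F.IsOptimalValue 0ℚ
  split-optimal = (split , split-feasible , split-objective) , (λ S feasible → Columns.Feasible.0≤objective gapInstance singletons S feasible)

  middleUses : C.Mapping 0F → ℕ
  middleUses m = C.Y m 0F (1F , true) ℕ.+ C.Y m 0F (1F , false)

  mcost≡middleUses*B : ∀ (m : C.Mapping 0F) → C.mcost m ≡ middleUses m ℕ.* B
  mcost≡middleUses*B m = normalise (C.Y m 0F (0F , true) ℕ.+ C.Y m 0F (0F , false)) (middleUses m)
                                   (C.Y m 0F (2F , true) ℕ.+ C.Y m 0F (2F , false)) B
    where
    open ℕ-Solver using (solve; _:+_; _:*_; con; _:=_)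
    -- The left-hand side is what C.mcost m computes to.
    normalise : ∀ a b c d → 0 ℕ.+ ((1 ℕ.* (a ℕ.* (1 ℕ.* 0) ℕ.+ (b ℕ.* (1 ℕ.* d) ℕ.+ (c ℕ.* (1 ℕ.* 0) ℕ.+ 0)))) ℕ.+ 0) ≡ b ℕ.* d
    normalise = solve 4 (λ a b c d → con 0 :+ ((con 1 :* (a :* (con 1 :* con 0) :+ (b :* (con 1 :* d) :+ (c :* (con 1 :* con 0) :+ con 0))))
                                       :+ con 0) := b :* d) refl

  left : Fin 4 → Bool
  left 0F = true
  left 1F = true
  left 2F = false
  left 3F = false

  crosses-middle : ∀ {u as v} → IsWalk P₄ u as v → left u ≢ left v → 1 ℕ.≤ count P₄ (1F , true) as ℕ.+ count P₄ (1F , false) as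
  crosses-middle nil                                  same-side = ⊥-elim (same-side refl)
  crosses-middle {as = (0F , true)  ∷ _}  (cons refl w) sides    = crosses-middle w sides
  crosses-middle {as = (0F , false) ∷ _}  (cons refl w) sides    = crosses-middle w sides
  crosses-middle {as = (1F , true)  ∷ _}  (cons refl w) _        = ℕ.s≤s ℕ.z≤n
  crosses-middle {as = (1F , false) ∷ as} (cons refl w) _        = ℕ.≤-trans (ℕ.s≤s ℕ.z≤n) (ℕ.m≤n+m (ℕ.suc (count P₄ (1F , false) as)) (count P₄ (1F , true) as))
  crosses-middle {as = (2F , true)  ∷ _}  (cons refl w) sides    = crosses-middle w sides
  crosses-middle {as = (2F , false) ∷ _}  (cons refl w) sides    = crosses-middle w sides

  opposite : ∀ u v → 1 ℕ.≤ nodeCapacity u → 1 ℕ.≤ nodeCapacity v → u ≢ v → left u ≢ left v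
  opposite 1F 2F _  _  _   = λ ()
  opposite 2F 1F _  _  _   = λ ()
  opposite 1F 1F _  _  u≢v = ⊥-elim (u≢v refl)
  opposite 2F 2F _  _  u≢v = ⊥-elim (u≢v refl)
  opposite 0F _  () _  _
  opposite 3F _  () _  _
  opposite 1F 0F _  () _
  opposite 1F 3F _  () _
  opposite 2F 0F _  () _
  opposite 2F 3F _  () _

  feasible-uses-middle : ∀ (m : C.FeasMapping 0F) → 1 ℕ.≤ middleUses (proj₁ m)
  feasible-uses-middle (m , injective , paths , nodeCap , _) =
    crosses-middle (proj₁ (paths 0F (refl , refl))) (opposite (mV 0F) (mV 1F) (occupied 0F) (occupied 1F) distinct)
    where
    open C.Mapping m
    placed : ∀ x → 1 ℕ.≤ 1 ℕ.* (1 ℕ.* C.X m x (mV x))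
    placed x with mV x ≟F mV x
    ... | yes _ = ℕ.≤-refl
    ... | no ≢  = ⊥-elim (≢ refl)
    occupied : ∀ x → 1 ℕ.≤ nodeCapacity (mV x)
    occupied x = ℕ.≤-trans (placed x) (ℕ.≤-trans (∑ℕ-≥-term 2 (λ x′ → 1 ℕ.* (1 ℕ.* C.X m x′ (mV x))) x) (nodeCap (mV x)))
    distinct : mV 0F ≢ mV 1F
    distinct same with injective 0F 1F refl refl same
    ... | ()

  throughMiddle : C.Mapping 0F
  throughMiddle = record { mV = λ { 0F → 1F ; 1F → 2F } ; mE = λ _ → (1F , true) ∷ [] }

  throughMiddle-feasible : C.IsFeasibleMapping throughMiddle
  throughMiddle-feasible = injective
                         , (λ { 0F _ → cons refl nil , ((λ ()) ∷ []) ∷ [] ∷ [] })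
                         , (λ { 0F → ℕ.z≤n ; 1F → ℕ.≤-refl ; 2F → ℕ.≤-refl ; 3F → ℕ.z≤n })
                         , (λ { 0F → ℕ.z≤n ; 1F → ℕ.≤-refl ; 2F → ℕ.z≤n })
    where
    injective : ∀ x x′ → C.inPart 0F x → C.inPart 0F x′ → C.Mapping.mV throughMiddle x ≡ C.Mapping.mV throughMiddle x′ → x ≡ x′
    injective 0F 0F _ _ _  = refl
    injective 0F 1F _ _ ()
    injective 1F 0F _ _ ()
    injective 1F 1F _ _ _  = refl

  routed : C.Solution
  routed = record { lam = λ { 0F → ((throughMiddle , throughMiddle-feasible) , 1ℚ) ∷ [] } ; y = λ _ _ → 0ℚ }

  routed-feasible : C.IsFeasible routed
  routed-feasible = (λ { 0F → (≤ᵇ⇒≤ tt , ≤ᵇ⇒≤ tt) ∷ [] })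
                  , (λ _ _ cut → ⊥-elim (cut refl))
                  , (λ { 0F → ≤ᵇ⇒≤ tt })
                  , (λ _ _ cut → ⊥-elim (cut refl))
                  , (λ { 0F → ≤ᵇ⇒≤ tt ; 1F → ≤ᵇ⇒≤ tt ; 2F → ≤ᵇ⇒≤ tt ; 3F → ≤ᵇ⇒≤ tt })
                  , (λ { 0F → ≤ᵇ⇒≤ tt ; 1F → ≤ᵇ⇒≤ tt ; 2F → ≤ᵇ⇒≤ tt ; 3F → ≤ᵇ⇒≤ tt })
                  , (λ { 0F → ≤ᵇ⇒≤ tt ; 1F → ≤ᵇ⇒≤ tt ; 2F → ≤ᵇ⇒≤ tt })
                  , (λ _ _ cut → ⊥-elim (cut refl))

  routed-objective : C.objective routed ≡ ℕ→ℚ B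
  routed-objective = begin
    (c * 1ℚ + 0ℚ) + 0ℚ + ∑ 3 cutCost  ≡⟨ cong₂ _+_ (trans (+-identityʳ _) (trans (+-identityʳ _) (*-identityʳ c))) (trans (∑-cong 3 uncut) (∑-zero 3)) ⟩
    c + 0ℚ                            ≡⟨ +-identityʳ c ⟩
    c                                 ≡⟨ cong ℕ→ℚ (trans (mcost≡middleUses*B throughMiddle) (ℕ.*-identityˡ B)) ⟩
    ℕ→ℚ B                             ∎
    where
    open ≡-Reasoning
    c : ℚ
    c = ℕ→ℚ (C.mcost throughMiddle)
    cutCost : Fin 3 → ℚ
    cutCost e = ∑ 1 (λ ē → [ C.cut? ē ] * (ℕ→ℚ (edgeCost e ℕ.* 1) * (0ℚ + 0ℚ)))
    uncut : ∀ e → cutCost e ≡ 0ℚ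
    uncut 0F = refl
    uncut 1F = cong (_+ 0ℚ) (*-zeroˡ (ℕ→ℚ (B ℕ.* 1) * (0ℚ + 0ℚ)))
    uncut 2F = refl

  routed-optimal : C.IsOptimalValue (ℕ→ℚ B)
  routed-optimal = (routed , routed-feasible , routed-objective) , lower-bound
    where
    lower-bound : ∀ S → C.IsFeasible S → ℕ→ℚ B ≤ C.objective S
    lower-bound S feasible = begin
      ℕ→ℚ B                                            ≡⟨ *-identityʳ (ℕ→ℚ B) ⟨
      ℕ→ℚ B * 1ℚ                                       ≤⟨ *-monoˡ-≤-≥0 (0≤ℕ→ℚ B) (covering 0F) ⟩
      ℕ→ℚ B * totalWeight S 0F                         ≡⟨ ∑λ-const S 0F (ℕ→ℚ B) ⟨
      C.∑λ S 0F (λ _ → ℕ→ℚ B)                          ≤⟨ ∑λ-mono-≤ S 0≤λ≤1 0F (λ _ → ℕ→ℚ B) (λ m → ℕ→ℚ (C.mcost m)) costly ⟩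
      C.∑λ S 0F (λ m → ℕ→ℚ (C.mcost m))                ≡⟨ +-identityʳ _ ⟨
      ∑ 1 (λ i → C.∑λ S i (λ m → ℕ→ℚ (C.mcost m)))     ≤⟨ mappingCosts≤objective ⟩
      C.objective S                                    ∎
      where
      open ≤-Reasoning
      open Columns gapInstance whole
      open Feasible S feasible
      costly : ∀ (m : C.FeasMapping 0F) → ℕ→ℚ B ≤ ℕ→ℚ (C.mcost (proj₁ m))
      costly m = ℕ→ℚ-mono-≤ (ℕ.≤-trans (ℕ.≤-reflexive (sym (ℕ.*-identityˡ B)))
                            (ℕ.≤-trans (ℕ.*-monoˡ-≤ B (feasible-uses-middle m)) (ℕ.≤-reflexive (sym (mcost≡middleUses*B (proj₁ m))))))

proposition2 :
    (∀ (I : Instance) → ValidInstance I →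
       (π π' : Partition (Graph.n (Instance.Gr I))) → Refines π' π →
       ∀ (v v' : ℚ) → VPF.IsOptimalValue I π v → VPF.IsOptimalValue I π' v' →
       v' ≤ v)
    ×
    (∀ (M : ℚ) → 0ℚ < M →
       Σ Instance λ I → ValidInstance I ×
       Σ (Partition (Graph.n (Instance.Gr I))) λ π →
       Σ (Partition (Graph.n (Instance.Gr I))) λ π' → Refines π' π ×
       Σ ℚ λ v → Σ ℚ λ v' →
         VPF.IsOptimalValue I π v × VPF.IsOptimalValue I π' v' × M < v - v')
proposition2 = (λ I valid → refinement-monotone I (proj₁ (proj₁ valid)))
             , λ M _ → let (B , M<B) = ℚ-archimedean M; open GapExample B in
                 gapInstance , gapInstance-valid , whole , singletons , singletons⊑whole , ℕ→ℚ B , 0ℚ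
               , routed-optimal , split-optimal , subst (M <_) (sym (+-identityʳ (ℕ→ℚ B))) M<B
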